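{- For positive integers $m,n$, $$\frac1m\sum_{k=0}^m\binom mk(-1)^k\frac{(1-2^{n+k})B_{n+k}}{n+k}(1-2^{m-k})B_{m-k} =\frac1n\sum_{k=1}^n\binom nk(-1)^k\frac{(1-2^{m+k})B_{m+k}}{m+k}B_{n-k}.$$
   Context: The Bernoulli polynomials $B_n(x)$ are defined by $\frac{ze^{xz}}{e^z-1}=\sum_{n\ge0}B_n(x)\frac{z^n}{n!}$, and the Bernoulli numbers are $B_n=B_n(0)$. -}

module Defs where

open import Data.Nat as ℕ using (ℕ; zero; suc)
open import Data.Nat.Combinatorics using (_C_)
open import Data.Integer as ℤ using (ℤ; +_)
open import Data.Rational using (ℚ; 0ℚ; 1ℚ; _+_; _*_; _-_; -_; _/_)
open import Data.List using (List; []; _∷_; reverse; length)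

-- Σ_{k=a}^{b} f k  (empty when b < a), over ℚ
sumFromTo : ℕ → ℕ → (ℕ → ℚ) → ℚ
sumFromTo a b f = go a (suc b ℕ.∸ a)
  where
  go : ℕ → ℕ → ℚ
  go i zero = 0ℚ
  go i (suc r) = f i + go (suc i) r

ℕ→ℚ : ℕ → ℚ
ℕ→ℚ n = (+ n) / 1

sgn : ℕ → ℚ
sgn zero = 1ℚ
sgn (suc k) = - sgn k

pow2 : ℕ → ℚ
pow2 k = ℕ→ℚ (2 ℕ.^ k)

-- Bernoulli numbers B_n = B_n(0), generating function z/(e^z - 1)
-- (so B_1 = -1/2), computed by the equivalent standard recurrence
--   B_0 = 1,  B_n = -(1/(n+1)) Σ_{k=0}^{n-1} C(n+1,k) B_k.
-- bernList n = [B_{n-1}, ..., B_0] (most recent first)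
private
  index : List ℚ → ℕ → ℚ
  index [] _ = 0ℚ
  index (x ∷ xs) zero = x
  index (x ∷ xs) (suc i) = index xs i

  nextB : ℕ → List ℚ → ℚ
  nextB zero _ = 1ℚ
  nextB n@(suc _) prev =
    - ((+ 1 / suc n) * sumFromTo 0 (n ℕ.∸ 1)
        (λ k → ℕ→ℚ (suc n C k) * index (reverse prev) k))

  bernList : ℕ → List ℚ
  bernList zero = []
  bernList (suc n) = nextB n (bernList n) ∷ bernList n

bernoulli : ℕ → ℚ
bernoulli n = nextB n (bernList n)

{-# OPTIONS --safe #-}
-- Let ℰ be the linear functional on polynomials with ℰ(xᵏ) = E_k(0)/2, where E_k is the k-th
-- Euler polynomial and E_k(0) = 2(1 - 2ᵏ⁺¹)B_{k+1}/(k+1) by the duplication formula for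
-- Bernoulli polynomials. It is characterised by ℰ(p(x+1)) + ℰ(p(x)) = p(0), and it is invariant
-- under x ↦ -1-x. Expanding in monomials, the left-hand side is X = ℰ(xⁿ⁻¹ E_{m-1}(-x))/2 and the
-- right-hand side is Y = ℰ(xᵐ⁻¹ Q(x)) with Q(x) = (B_n(-x) - B_n)/n. The characterisation applied
-- to xⁿ⁻¹ E_{m-1}(-x) and to Q(x-1) E_{m-1}(1-x), together with E_k(x+1) + E_k(x) = 2xᵏ and
-- Q(x-1) = Q(x) + (-x)ⁿ⁻¹, gives two linear relations between X, Y and ℰ(xⁿ⁺ᵐ⁻²) which
-- together force X = Y.
module Submission where

open import Defs
open import Data.List using (List; []; _∷_)
open import Data.Nat as ℕ using (ℕ; zero; suc; _≤_; _<_; z≤n; s≤s; z<s; _∸_)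
import Data.Nat.Properties as ℕₚ
open import Data.Nat.Induction using (<-rec)
open import Data.Nat.Combinatorics using (_C_; nCk+nC[k+1]≡[n+1]C[k+1]; nCk≡nC[n∸k]; nCn≡1; nC1≡n)
open import Data.Nat.Combinatorics.Specification using (k>n⇒nCk≡0)
import Data.Nat.Coprimality as Coprime
import Data.Integer as ℤ
import Data.Integer.Properties as ℤₚ
open import Data.Rational using (ℚ; mkℚ; 0ℚ; 1ℚ; _+_; _*_; -_; _-_; _/_)
import Data.Rational.Properties as ℚ
open import Algebra.Properties.Group ℚ.+-0-group using (x∙y⁻¹≈ε⇒x≈y)
open import Data.Sum using (inj₁; inj₂)
open import Function using (_∘_)
open import Level using (0ℓ)
open import Relation.Binary.PropositionalEquality
open import Relation.Nullary.Decidable using (dec⇒maybe)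
open import Tactic.RingSolver using (solve-∀)
open import Tactic.RingSolver.Core.AlmostCommutativeRing using (AlmostCommutativeRing; fromCommutativeRing)
open ≡-Reasoning

ring : AlmostCommutativeRing 0ℓ 0ℓ
ring = fromCommutativeRing ℚ.+-*-commutativeRing (λ x → dec⇒maybe (0ℚ ℚ.≟ x))

½ : ℚ
½ = ℤ.+ 1 / 2

2ℚ : ℚ
2ℚ = 1ℚ + 1ℚ

recip : ℕ → ℚ
recip n = ℤ.+ 1 / suc n

x-y≡0⇒x≡y : ∀ {x y} → x - y ≡ 0ℚ → x ≡ y
x-y≡0⇒x≡y {x} {y} = x∙y⁻¹≈ε⇒x≈y x y

x+x≡0⇒x≡0 : ∀ {x} → x + x ≡ 0ℚ → x ≡ 0ℚ
x+x≡0⇒x≡0 {x} x+x≡0 = begin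
  x           ≡⟨ halve x ⟩
  ½ * (x + x) ≡⟨ cong (½ *_) x+x≡0 ⟩
  ½ * 0ℚ      ≡⟨ ℚ.*-zeroʳ ½ ⟩
  0ℚ          ∎
  where
  halve : ∀ x → x ≡ ½ * (x + x)
  halve = solve-∀ ring

x≡y⇒x-y≡0 : ∀ {x y} → x ≡ y → x - y ≡ 0ℚ
x≡y⇒x-y≡0 {x} refl = ℚ.+-inverseʳ x

x+y≡z⇒x≡z-y : ∀ {x y z} → x + y ≡ z → x ≡ z - y
x+y≡z⇒x≡z-y {x} {y} refl = sym (cancel x y)
  where
  cancel : ∀ x y → x + y - y ≡ x
  cancel = solve-∀ ring

x+y≡z⇒y≡z-x : ∀ {x y z} → x + y ≡ z → y ≡ z - x
x+y≡z⇒y≡z-x {x} {y} eq = x+y≡z⇒x≡z-y (trans (ℚ.+-comm y x) eq)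

-[x-1]≡-x+1 : ∀ x → - (x - 1ℚ) ≡ - x + 1ℚ
-[x-1]≡-x+1 = solve-∀ ring

ℕ→ℚ≡mkℚ : ∀ n → ℕ→ℚ n ≡ mkℚ (ℤ.+ n) 0 (Coprime.sym (Coprime.1-coprimeTo n))
ℕ→ℚ≡mkℚ n = ℚ.normalize-coprime (Coprime.sym (Coprime.1-coprimeTo n))

ℕ→ℚ-suc : ∀ n → ℕ→ℚ (suc n) ≡ 1ℚ + ℕ→ℚ n
ℕ→ℚ-suc n = sym (trans (cong (1ℚ +_) (ℕ→ℚ≡mkℚ n))
                       (ℚ./-cong (cong (ℤ._+_ (ℤ.+ 1)) (ℤₚ.*-identityʳ (ℤ.+ n))) refl))

ℕ→ℚ-+ : ∀ m n → ℕ→ℚ (m ℕ.+ n) ≡ ℕ→ℚ m + ℕ→ℚ n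
ℕ→ℚ-+ zero    n = sym (ℚ.+-identityˡ (ℕ→ℚ n))
ℕ→ℚ-+ (suc m) n = begin
  ℕ→ℚ (suc (m ℕ.+ n))   ≡⟨ ℕ→ℚ-suc (m ℕ.+ n) ⟩
  1ℚ + ℕ→ℚ (m ℕ.+ n)    ≡⟨ cong (1ℚ +_) (ℕ→ℚ-+ m n) ⟩
  1ℚ + (ℕ→ℚ m + ℕ→ℚ n)  ≡⟨ ℚ.+-assoc 1ℚ (ℕ→ℚ m) (ℕ→ℚ n) ⟨
  1ℚ + ℕ→ℚ m + ℕ→ℚ n    ≡⟨ cong (_+ ℕ→ℚ n) (ℕ→ℚ-suc m) ⟨
  ℕ→ℚ (suc m) + ℕ→ℚ n   ∎

recip-inverse : ∀ n → recip n * ℕ→ℚ (suc n) ≡ 1ℚ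
recip-inverse n = trans
  (cong₂ _*_ (ℚ.normalize-coprime (Coprime.1-coprimeTo (suc n))) (ℕ→ℚ≡mkℚ (suc n)))
  (ℚ.*-inverseˡ (mkℚ (ℤ.+ suc n) 0 (Coprime.sym (Coprime.1-coprimeTo (suc n)))))

*-cancelˡ-ℕ→ℚ-suc : ∀ n {x y} → ℕ→ℚ (suc n) * x ≡ ℕ→ℚ (suc n) * y → x ≡ y
*-cancelˡ-ℕ→ℚ-suc n {x} {y} eq = begin
  x                            ≡⟨ unscale x ⟩
  recip n * (ℕ→ℚ (suc n) * x)  ≡⟨ cong (recip n *_) eq ⟩
  recip n * (ℕ→ℚ (suc n) * y)  ≡⟨ unscale y ⟨
  y                            ∎
  where
  unscale : ∀ z → z ≡ recip n * (ℕ→ℚ (suc n) * z)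
  unscale z = begin
    z                            ≡⟨ ℚ.*-identityˡ z ⟨
    1ℚ * z                       ≡⟨ cong (_* z) (recip-inverse n) ⟨
    recip n * ℕ→ℚ (suc n) * z    ≡⟨ ℚ.*-assoc (recip n) (ℕ→ℚ (suc n)) z ⟩
    recip n * (ℕ→ℚ (suc n) * z)  ∎

[1+n]Cn≡1+n : ∀ n → suc n C n ≡ suc n
[1+n]Cn≡1+n n = begin
  suc n C n                ≡⟨ nCk≡nC[n∸k] (ℕₚ.n≤1+n n) ⟩
  suc n C (suc n ∸ n)      ≡⟨ cong (suc n C_) (ℕₚ.m+n∸n≡m 1 n) ⟩
  suc n C 1                ≡⟨ nC1≡n (suc n) ⟩
  suc n                    ∎

δ₀ : ℕ → ℚ
δ₀ zero    = 1ℚ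
δ₀ (suc _) = 0ℚ

δ₁ : ℕ → ℚ
δ₁ zero    = 0ℚ
δ₁ (suc k) = δ₀ k

sgn-+ : ∀ m n → sgn (m ℕ.+ n) ≡ sgn m * sgn n
sgn-+ zero    n = sym (ℚ.*-identityˡ (sgn n))
sgn-+ (suc m) n = trans (cong -_ (sgn-+ m n)) (ℚ.neg-distribˡ-* (sgn m) (sgn n))

sgn-cancel : ∀ k x → sgn k * (sgn k * x) ≡ x
sgn-cancel zero    x = trans (ℚ.*-identityˡ _) (ℚ.*-identityˡ x)
sgn-cancel (suc k) x = trans (negate-both (sgn k) x) (sgn-cancel k x)
  where
  negate-both : ∀ s x → (- s) * ((- s) * x) ≡ s * (s * x)
  negate-both = solve-∀ ring

infixr 8 _^_

_^_ : ℚ → ℕ → ℚ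
x ^ zero  = 1ℚ
x ^ suc k = x * x ^ k

^-distribˡ-+-* : ∀ x m n → x ^ (m ℕ.+ n) ≡ x ^ m * x ^ n
^-distribˡ-+-* x zero    n = sym (ℚ.*-identityˡ (x ^ n))
^-distribˡ-+-* x (suc m) n = trans (cong (x *_) (^-distribˡ-+-* x m n)) (sym (ℚ.*-assoc x (x ^ m) (x ^ n)))

neg-^ : ∀ x k → (- x) ^ k ≡ sgn k * x ^ k
neg-^ x zero    = refl
neg-^ x (suc k) = trans (cong ((- x) *_) (neg-^ x k)) (regroup x (sgn k) (x ^ k))
  where
  regroup : ∀ x s p → (- x) * (s * p) ≡ (- s) * (x * p)
  regroup = solve-∀ ring

1^k≡1 : ∀ k → 1ℚ ^ k ≡ 1ℚ
1^k≡1 zero    = refl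
1^k≡1 (suc k) = trans (ℚ.*-identityˡ (1ℚ ^ k)) (1^k≡1 k)

0^k≡δ₀ : ∀ k → 0ℚ ^ k ≡ δ₀ k
0^k≡δ₀ zero    = refl
0^k≡δ₀ (suc k) = ℚ.*-zeroˡ (0ℚ ^ k)

^-*-δ₁ : ∀ x k → x ^ k * δ₁ k ≡ x * δ₁ k
^-*-δ₁ x zero          = trans (ℚ.*-zeroʳ 1ℚ) (sym (ℚ.*-zeroʳ x))
^-*-δ₁ x (suc zero)    = cong (_* 1ℚ) (ℚ.*-identityʳ x)
^-*-δ₁ x (suc (suc k)) = trans (ℚ.*-zeroʳ (x ^ suc (suc k))) (sym (ℚ.*-zeroʳ x))

pow2≡2^ : ∀ k → pow2 k ≡ 2ℚ ^ k
pow2≡2^ zero    = refl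
pow2≡2^ (suc k) = begin
  ℕ→ℚ (2 ℕ.^ k ℕ.+ (2 ℕ.^ k ℕ.+ 0))          ≡⟨ ℕ→ℚ-+ (2 ℕ.^ k) (2 ℕ.^ k ℕ.+ 0) ⟩
  pow2 k + ℕ→ℚ (2 ℕ.^ k ℕ.+ 0)               ≡⟨ cong (pow2 k +_) (ℕ→ℚ-+ (2 ℕ.^ k) 0) ⟩
  pow2 k + (pow2 k + 0ℚ)                     ≡⟨ double (pow2 k) ⟩
  2ℚ * pow2 k                                ≡⟨ cong (2ℚ *_) (pow2≡2^ k) ⟩
  2ℚ * 2ℚ ^ k                                ∎
  where
  double : ∀ x → x + (x + 0ℚ) ≡ 2ℚ * x
  double = solve-∀ ring

∑ : ℕ → ℕ → (ℕ → ℚ) → ℚ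
∑ i zero    f = 0ℚ
∑ i (suc r) f = f i + ∑ (suc i) r f

sumFromTo≡∑ : ∀ a b (f : ℕ → ℚ) → sumFromTo a b f ≡ ∑ a (suc b ∸ a) f
sumFromTo≡∑ a b f = by-length (suc b ∸ a) a b refl
  where
  pred-∸ : ∀ a b {r} → suc b ∸ a ≡ suc r → b ∸ a ≡ r
  pred-∸ a b eq = trans (sym (ℕₚ.pred[m∸n]≡m∸[1+n] (suc b) a)) (cong ℕ.pred eq)

  by-length : ∀ r a b → suc b ∸ a ≡ r → sumFromTo a b f ≡ ∑ a r f
  by-length zero    a b eq rewrite eq = refl
  by-length (suc r) a b eq rewrite eq | sym (pred-∸ a b eq) = cong (f a +_)
    (trans (by-length r (suc a) b (pred-∸ a b eq)) (cong (λ t → ∑ (suc a) t f) (sym (pred-∸ a b eq))))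

∑-cong : ∀ i r {f g : ℕ → ℚ} → (∀ k → k < i ℕ.+ r → f k ≡ g k) → ∑ i r f ≡ ∑ i r g
∑-cong i zero    h = refl
∑-cong i (suc r) h = cong₂ _+_ (h i (ℕₚ.m<m+n i z<s))
  (∑-cong (suc i) r (λ k k< → h k (subst (k <_) (sym (ℕₚ.+-suc i r)) k<)))

∑-shift : ∀ i r (f : ℕ → ℚ) → ∑ (suc i) r f ≡ ∑ i r (f ∘ suc)
∑-shift i zero    f = refl
∑-shift i (suc r) f = cong (f (suc i) +_) (∑-shift (suc i) r f)

∑-snoc : ∀ i r (f : ℕ → ℚ) → ∑ i (suc r) f ≡ ∑ i r f + f (i ℕ.+ r)
∑-snoc i zero    f = begin
  f i + 0ℚ          ≡⟨ ℚ.+-comm (f i) 0ℚ ⟩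
  0ℚ + f i          ≡⟨ cong (λ j → 0ℚ + f j) (ℕₚ.+-identityʳ i) ⟨
  0ℚ + f (i ℕ.+ 0)  ∎
∑-snoc i (suc r) f = begin
  f i + ∑ (suc i) (suc r) f                  ≡⟨ cong (f i +_) (∑-snoc (suc i) r f) ⟩
  f i + (∑ (suc i) r f + f (suc i ℕ.+ r))    ≡⟨ ℚ.+-assoc (f i) _ _ ⟨
  f i + ∑ (suc i) r f + f (suc i ℕ.+ r)      ≡⟨ cong (λ j → f i + ∑ (suc i) r f + f j) (ℕₚ.+-suc i r) ⟨
  f i + ∑ (suc i) r f + f (i ℕ.+ suc r)      ∎

∑-+ : ∀ i r (f g : ℕ → ℚ) → ∑ i r (λ k → f k + g k) ≡ ∑ i r f + ∑ i r g
∑-+ i zero    f g = refl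
∑-+ i (suc r) f g = trans (cong (f i + g i +_) (∑-+ (suc i) r f g)) (interchange (f i) (g i) _ _)
  where
  interchange : ∀ a b c d → a + b + (c + d) ≡ a + c + (b + d)
  interchange = solve-∀ ring

*-distribˡ-∑ : ∀ c i r (f : ℕ → ℚ) → c * ∑ i r f ≡ ∑ i r (λ k → c * f k)
*-distribˡ-∑ c i zero    f = ℚ.*-zeroʳ c
*-distribˡ-∑ c i (suc r) f = trans (ℚ.*-distribˡ-+ c (f i) (∑ (suc i) r f)) (cong (c * f i +_) (*-distribˡ-∑ c (suc i) r f))

∑-reverse : ∀ n (f : ℕ → ℚ) → ∑ 0 n f ≡ ∑ 0 n (λ k → f (n ∸ suc k))
∑-reverse zero    f = refl
∑-reverse (suc n) f = begin
  f 0 + ∑ 1 n f                                ≡⟨ cong (f 0 +_) (∑-shift 0 n f) ⟩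
  f 0 + ∑ 0 n (f ∘ suc)                        ≡⟨ cong (f 0 +_) (∑-reverse n (f ∘ suc)) ⟩
  f 0 + ∑ 0 n (λ k → f (suc (n ∸ suc k)))      ≡⟨ ℚ.+-comm (f 0) _ ⟩
  ∑ 0 n (λ k → f (suc (n ∸ suc k))) + f 0      ≡⟨ cong₂ _+_ (∑-cong 0 n (λ k k<n → cong f (ℕₚ.+-∸-assoc 1 k<n)))
                                                             (cong f (ℕₚ.n∸n≡0 n)) ⟨
  ∑ 0 n (λ k → f (n ∸ k)) + f (n ∸ n)          ≡⟨ ∑-snoc 0 n (λ k → f (n ∸ k)) ⟨
  ∑ 0 (suc n) (λ k → f (n ∸ k))                ∎

-- Appell sequences

-- appell f n x = Σₖ C(n,k) f(k) xⁿ⁻ᵏ; appell bernoulli n is the Bernoulli polynomial B_n,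
-- and k ↦ appell u k 1ℚ is the binomial transform of u.
appell : (ℕ → ℚ) → ℕ → ℚ → ℚ
appell f zero    x = f 0
appell f (suc n) x = x * appell f n x + appell (f ∘ suc) n x

appell-cong : ∀ {f g : ℕ → ℚ} n x → (∀ k → k ≤ n → f k ≡ g k) → appell f n x ≡ appell g n x
appell-cong zero    x h = h 0 z≤n
appell-cong (suc n) x h = cong₂ (λ a b → x * a + b)
  (appell-cong n x (λ k k≤n → h k (ℕₚ.m≤n⇒m≤1+n k≤n)))
  (appell-cong n x (λ k k≤n → h (suc k) (s≤s k≤n)))

appell-+ : ∀ (f g : ℕ → ℚ) n x → appell (λ k → f k + g k) n x ≡ appell f n x + appell g n x
appell-+ f g zero    x = refl
appell-+ f g (suc n) x = trans
  (cong₂ (λ a b → x * a + b) (appell-+ f g n x) (appell-+ (f ∘ suc) (g ∘ suc) n x))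
  (interchange x (appell f n x) (appell g n x) _ _)
  where
  interchange : ∀ x a b c d → x * (a + b) + (c + d) ≡ (x * a + c) + (x * b + d)
  interchange = solve-∀ ring

appell-- : ∀ (f g : ℕ → ℚ) n x → appell (λ k → f k - g k) n x ≡ appell f n x - appell g n x
appell-- f g zero    x = refl
appell-- f g (suc n) x = trans
  (cong₂ (λ a b → x * a + b) (appell-- f g n x) (appell-- (f ∘ suc) (g ∘ suc) n x))
  (interchange x (appell f n x) (appell g n x) _ _)
  where
  interchange : ∀ x a b c d → x * (a - b) + (c - d) ≡ (x * a + c) - (x * b + d)
  interchange = solve-∀ ring

appell-* : ∀ c (f : ℕ → ℚ) n x → appell (λ k → c * f k) n x ≡ c * appell f n x
appell-* c f zero    x = refl
appell-* c f (suc n) x = trans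
  (cong₂ (λ a b → x * a + b) (appell-* c f n x) (appell-* c (f ∘ suc) n x))
  (factor c x (appell f n x) _)
  where
  factor : ∀ c x a b → x * (c * a) + c * b ≡ c * (x * a + b)
  factor = solve-∀ ring

appell-0 : ∀ (f : ℕ → ℚ) n → appell f n 0ℚ ≡ f n
appell-0 f zero    = refl
appell-0 f (suc n) = trans (cong (0ℚ * appell f n 0ℚ +_) (appell-0 (f ∘ suc) n))
                           (drop (appell f n 0ℚ) (f (suc n)))
  where
  drop : ∀ a b → 0ℚ * a + b ≡ b
  drop = solve-∀ ring

appell-appell : ∀ (f : ℕ → ℚ) n x y → appell (λ k → appell f k y) n x ≡ appell f n (x + y)
appell-appell f zero    x y = refl
appell-appell f (suc n) x y = begin
  x * appell (λ k → appell f k y) n x + appell (λ k → y * appell f k y + appell (f ∘ suc) k y) n x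
    ≡⟨ cong (x * appell (λ k → appell f k y) n x +_) (trans
         (appell-+ (λ k → y * appell f k y) (λ k → appell (f ∘ suc) k y) n x)
         (cong (_+ appell (λ k → appell (f ∘ suc) k y) n x) (appell-* y (λ k → appell f k y) n x))) ⟩
  x * appell (λ k → appell f k y) n x + (y * appell (λ k → appell f k y) n x + appell (λ k → appell (f ∘ suc) k y) n x)
    ≡⟨ cong₂ (λ a b → x * a + (y * a + b)) (appell-appell f n x y) (appell-appell (f ∘ suc) n x y) ⟩
  x * appell f n (x + y) + (y * appell f n (x + y) + appell (f ∘ suc) n (x + y))
    ≡⟨ collect x y (appell f n (x + y)) _ ⟩
  (x + y) * appell f n (x + y) + appell (f ∘ suc) n (x + y)
    ∎
  where
  collect : ∀ x y a b → x * a + (y * a + b) ≡ (x + y) * a + b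
  collect = solve-∀ ring

appell-zero : ∀ n x → appell (λ _ → 0ℚ) n x ≡ 0ℚ
appell-zero zero    x = refl
appell-zero (suc n) x = trans (cong (λ a → x * a + a) (appell-zero n x)) (vanish x)
  where
  vanish : ∀ x → x * 0ℚ + 0ℚ ≡ 0ℚ
  vanish = solve-∀ ring

appell-δ₀ : ∀ n x → appell δ₀ n x ≡ x ^ n
appell-δ₀ zero    x = refl
appell-δ₀ (suc n) x = trans (cong₂ (λ a b → x * a + b) (appell-δ₀ n x) (appell-zero n x))
                            (ℚ.+-identityʳ (x * x ^ n))

appell-pow : ∀ n x y → appell (λ k → y ^ k) n x ≡ (x + y) ^ n
appell-pow n x y = begin
  appell (λ k → y ^ k) n x              ≡⟨ appell-cong n x (λ k _ → appell-δ₀ k y) ⟨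
  appell (λ k → appell δ₀ k y) n x      ≡⟨ appell-appell δ₀ n x y ⟩
  appell δ₀ n (x + y)                   ≡⟨ appell-δ₀ n (x + y) ⟩
  (x + y) ^ n                           ∎

appell-sgn : ∀ (f : ℕ → ℚ) n x → appell (λ k → sgn k * f k) n x ≡ sgn n * appell f n (- x)
appell-sgn f zero    x = refl
appell-sgn f (suc n) x = begin
  x * appell (λ k → sgn k * f k) n x + appell (λ k → - sgn k * f (suc k)) n x
    ≡⟨ cong (x * appell (λ k → sgn k * f k) n x +_) (trans
         (appell-cong n x (λ k _ → pull-sign (sgn k) (f (suc k))))
         (appell-* (- 1ℚ) (λ k → sgn k * f (suc k)) n x)) ⟩
  x * appell (λ k → sgn k * f k) n x + - 1ℚ * appell (λ k → sgn k * f (suc k)) n x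
    ≡⟨ cong₂ (λ a b → x * a + - 1ℚ * b) (appell-sgn f n x) (appell-sgn (f ∘ suc) n x) ⟩
  x * (sgn n * appell f n (- x)) + - 1ℚ * (sgn n * appell (f ∘ suc) n (- x))
    ≡⟨ regroup x (sgn n) (appell f n (- x)) (appell (f ∘ suc) n (- x)) ⟩
  - sgn n * ((- x) * appell f n (- x) + appell (f ∘ suc) n (- x))
    ∎
  where
  pull-sign : ∀ s y → - s * y ≡ - 1ℚ * (s * y)
  pull-sign = solve-∀ ring
  regroup : ∀ x s a b → x * (s * a) + - 1ℚ * (s * b) ≡ - s * ((- x) * a + b)
  regroup = solve-∀ ring

appell-scale : ∀ r (f : ℕ → ℚ) n x → appell (λ k → r ^ k * f k) n (r * x) ≡ r ^ n * appell f n x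
appell-scale r f zero    x = refl
appell-scale r f (suc n) x = begin
  r * x * appell (λ k → r ^ k * f k) n (r * x) + appell (λ k → r * r ^ k * f (suc k)) n (r * x)
    ≡⟨ cong (r * x * appell (λ k → r ^ k * f k) n (r * x) +_) (trans
         (appell-cong n (r * x) (λ k _ → ℚ.*-assoc r (r ^ k) (f (suc k))))
         (appell-* r (λ k → r ^ k * f (suc k)) n (r * x))) ⟩
  r * x * appell (λ k → r ^ k * f k) n (r * x) + r * appell (λ k → r ^ k * f (suc k)) n (r * x)
    ≡⟨ cong₂ (λ a b → r * x * a + r * b) (appell-scale r f n x) (appell-scale r (f ∘ suc) n x) ⟩
  r * x * (r ^ n * appell f n x) + r * (r ^ n * appell (f ∘ suc) n x)
    ≡⟨ regroup r x (r ^ n) (appell f n x) (appell (f ∘ suc) n x) ⟩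
  r * r ^ n * (x * appell f n x + appell (f ∘ suc) n x)
    ∎
  where
  regroup : ∀ r x p a b → r * x * (p * a) + r * (p * b) ≡ r * p * (x * a + b)
  regroup = solve-∀ ring

-- Multiplies the exponential generating function of f by z.
zMul : (ℕ → ℚ) → ℕ → ℚ
zMul f zero    = 0ℚ
zMul f (suc k) = ℕ→ℚ (suc k) * f k

zMul-suc : ∀ (f : ℕ → ℚ) k → zMul f (suc k) ≡ f k + zMul (f ∘ suc) k
zMul-suc f zero    = trans (ℚ.*-identityˡ (f 0)) (sym (ℚ.+-identityʳ (f 0)))
zMul-suc f (suc k) = trans (cong (_* f (suc k)) (ℕ→ℚ-suc (suc k))) (split (ℕ→ℚ (suc k)) (f (suc k)))
  where
  split : ∀ m y → (1ℚ + m) * y ≡ y + m * y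
  split = solve-∀ ring

appell-zMul : ∀ (f : ℕ → ℚ) n x → appell (zMul f) (suc n) x ≡ ℕ→ℚ (suc n) * appell f n x
appell-zMul f zero    x = trans (cong (_+ 1ℚ * f 0) (ℚ.*-zeroʳ x)) (ℚ.+-identityˡ (1ℚ * f 0))
appell-zMul f (suc n) x = begin
  x * appell (zMul f) (suc n) x + appell (zMul f ∘ suc) (suc n) x
    ≡⟨ cong (x * appell (zMul f) (suc n) x +_) (trans
         (appell-cong (suc n) x (λ k _ → zMul-suc f k))
         (appell-+ f (zMul (f ∘ suc)) (suc n) x)) ⟩
  x * appell (zMul f) (suc n) x + (appell f (suc n) x + appell (zMul (f ∘ suc)) (suc n) x)
    ≡⟨ cong₂ (λ a b → x * a + (appell f (suc n) x + b)) (appell-zMul f n x) (appell-zMul (f ∘ suc) n x) ⟩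
  x * (ℕ→ℚ (suc n) * A) + ((x * A + A′) + ℕ→ℚ (suc n) * A′)
    ≡⟨ regroup x (ℕ→ℚ (suc n)) A A′ ⟩
  (1ℚ + ℕ→ℚ (suc n)) * (x * A + A′)
    ≡⟨ cong (_* (x * A + A′)) (ℕ→ℚ-suc (suc n)) ⟨
  ℕ→ℚ (suc (suc n)) * (x * A + A′)
    ∎
  where
  A A′ : ℚ
  A  = appell f n x
  A′ = appell (f ∘ suc) n x
  regroup : ∀ x m a b → x * (m * a) + ((x * a + b) + m * b) ≡ (1ℚ + m) * (x * a + b)
  regroup = solve-∀ ring

appell-δ₁ : ∀ n x → appell δ₁ (suc n) x ≡ ℕ→ℚ (suc n) * x ^ n
appell-δ₁ n x = begin
  appell δ₁ (suc n) x              ≡⟨ appell-cong (suc n) x δ₁≡zMul-δ₀ ⟩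
  appell (zMul δ₀) (suc n) x       ≡⟨ appell-zMul δ₀ n x ⟩
  ℕ→ℚ (suc n) * appell δ₀ n x      ≡⟨ cong (ℕ→ℚ (suc n) *_) (appell-δ₀ n x) ⟩
  ℕ→ℚ (suc n) * x ^ n              ∎
  where
  δ₁≡zMul-δ₀ : ∀ k → k ≤ suc n → δ₁ k ≡ zMul δ₀ k
  δ₁≡zMul-δ₀ zero          _ = refl
  δ₁≡zMul-δ₀ (suc zero)    _ = refl
  δ₁≡zMul-δ₀ (suc (suc k)) _ = sym (ℚ.*-zeroʳ (ℕ→ℚ (suc (suc k))))

appell-below : ∀ (D : ℕ → ℚ) n x → (∀ i → i < n → D i ≡ 0ℚ) → appell D n x ≡ D n
appell-below D zero    x _ = refl
appell-below D (suc n) x h = begin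
  x * appell D n x + appell (D ∘ suc) n x  ≡⟨ cong₂ (λ a b → x * a + b)
                                               (trans (appell-below D n x (λ i i<n → h i (ℕₚ.m<n⇒m<1+n i<n))) (h n ℕₚ.≤-refl))
                                               (appell-below (D ∘ suc) n x (λ i i<n → h (suc i) (s≤s i<n))) ⟩
  x * 0ℚ + D (suc n)                       ≡⟨ cong (_+ D (suc n)) (ℚ.*-zeroʳ x) ⟩
  0ℚ + D (suc n)                           ≡⟨ ℚ.+-identityˡ (D (suc n)) ⟩
  D (suc n)                                ∎

appell-below-suc : ∀ (D : ℕ → ℚ) n x → (∀ i → i < n → D i ≡ 0ℚ) →
                   appell D (suc n) x ≡ ℕ→ℚ (suc n) * (x * D n) + D (suc n)
appell-below-suc D zero    x _ = cong (_+ D 1) (sym (ℚ.*-identityˡ (x * D 0)))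
appell-below-suc D (suc n) x h = begin
  x * appell D (suc n) x + appell (D ∘ suc) (suc n) x
    ≡⟨ cong₂ (λ a b → x * a + b) (appell-below D (suc n) x h)
                                 (appell-below-suc (D ∘ suc) n x (λ i i<n → h (suc i) (s≤s i<n))) ⟩
  x * D (suc n) + (ℕ→ℚ (suc n) * (x * D (suc n)) + D (suc (suc n)))
    ≡⟨ regroup (x * D (suc n)) (ℕ→ℚ (suc n)) (D (suc (suc n))) ⟩
  (1ℚ + ℕ→ℚ (suc n)) * (x * D (suc n)) + D (suc (suc n))
    ≡⟨ cong (λ m → m * (x * D (suc n)) + D (suc (suc n))) (ℕ→ℚ-suc (suc n)) ⟨
  ℕ→ℚ (suc (suc n)) * (x * D (suc n)) + D (suc (suc n))
    ∎
  where
  regroup : ∀ a m b → a + (m * a + b) ≡ (1ℚ + m) * a + b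
  regroup = solve-∀ ring

∑-pascal : ∀ n (h : ℕ → ℚ) → ∑ 0 (suc (suc n)) (λ k → ℕ→ℚ (suc n C k) * h k) ≡
           ∑ 0 (suc n) (λ k → ℕ→ℚ (n C k) * h (suc k)) + ∑ 0 (suc n) (λ k → ℕ→ℚ (n C k) * h k)
∑-pascal n h = begin
  1ℚ * h 0 + ∑ 1 (suc n) (λ k → ℕ→ℚ (suc n C k) * h k)
    ≡⟨ cong (1ℚ * h 0 +_) (∑-shift 0 (suc n) (λ k → ℕ→ℚ (suc n C k) * h k)) ⟩
  1ℚ * h 0 + ∑ 0 (suc n) (λ k → ℕ→ℚ (suc n C suc k) * h (suc k))
    ≡⟨ cong (1ℚ * h 0 +_) (trans (∑-cong 0 (suc n) (λ k _ → pascal k)) (∑-+ 0 (suc n) A B)) ⟩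
  1ℚ * h 0 + (∑ 0 (suc n) A + ∑ 0 (suc n) B)
    ≡⟨ cong (λ t → 1ℚ * h 0 + (∑ 0 (suc n) A + t)) (trans (∑-snoc 0 n B) (trans (cong (∑ 0 n B +_) B-top) (ℚ.+-identityʳ (∑ 0 n B)))) ⟩
  1ℚ * h 0 + (∑ 0 (suc n) A + ∑ 0 n B)
    ≡⟨ regroup (1ℚ * h 0) (∑ 0 (suc n) A) (∑ 0 n B) ⟩
  ∑ 0 (suc n) A + (1ℚ * h 0 + ∑ 0 n B)
    ≡⟨ cong (λ t → ∑ 0 (suc n) A + (1ℚ * h 0 + t)) (∑-shift 0 n (λ k → ℕ→ℚ (n C k) * h k)) ⟨
  ∑ 0 (suc n) A + ∑ 0 (suc n) (λ k → ℕ→ℚ (n C k) * h k)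
    ∎
  where
  A B : ℕ → ℚ
  A k = ℕ→ℚ (n C k) * h (suc k)
  B k = ℕ→ℚ (n C suc k) * h (suc k)
  pascal : ∀ k → ℕ→ℚ (suc n C suc k) * h (suc k) ≡ A k + B k
  pascal k = begin
    ℕ→ℚ (suc n C suc k) * h (suc k)                       ≡⟨ cong (λ c → ℕ→ℚ c * h (suc k)) (nCk+nC[k+1]≡[n+1]C[k+1] n k) ⟨
    ℕ→ℚ (n C k ℕ.+ n C suc k) * h (suc k)                 ≡⟨ cong (_* h (suc k)) (ℕ→ℚ-+ (n C k) (n C suc k)) ⟩
    (ℕ→ℚ (n C k) + ℕ→ℚ (n C suc k)) * h (suc k)           ≡⟨ ℚ.*-distribʳ-+ (h (suc k)) (ℕ→ℚ (n C k)) (ℕ→ℚ (n C suc k)) ⟩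
    A k + B k                                             ∎
  B-top : B n ≡ 0ℚ
  B-top = trans (cong (λ c → ℕ→ℚ c * h (suc n)) (k>n⇒nCk≡0 (ℕₚ.n<1+n n))) (ℚ.*-zeroˡ (h (suc n)))
  regroup : ∀ a b c → a + (b + c) ≡ b + (a + c)
  regroup = solve-∀ ring

appell-explicit : ∀ (f : ℕ → ℚ) n x → appell f n x ≡ ∑ 0 (suc n) (λ k → ℕ→ℚ (n C k) * (x ^ k * f (n ∸ k)))
appell-explicit f zero    x = sym (trans (ℚ.+-identityʳ _) (trans (ℚ.*-identityˡ _) (ℚ.*-identityˡ (f 0))))
appell-explicit f (suc n) x = begin
  x * appell f n x + appell (f ∘ suc) n x
    ≡⟨ cong₂ (λ a b → x * a + b) (appell-explicit f n x) (appell-explicit (f ∘ suc) n x) ⟩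
  x * ∑ 0 (suc n) (λ k → ℕ→ℚ (n C k) * (x ^ k * f (n ∸ k))) + ∑ 0 (suc n) (λ k → ℕ→ℚ (n C k) * (x ^ k * f (suc (n ∸ k))))
    ≡⟨ cong₂ _+_ (trans (∑-cong 0 (suc n) (λ k _ → shuffle x (ℕ→ℚ (n C k)) (x ^ k) (f (n ∸ k))))
                        (sym (*-distribˡ-∑ x 0 (suc n) (λ k → ℕ→ℚ (n C k) * (x ^ k * f (n ∸ k))))))
                 (∑-cong 0 (suc n) (λ k k<1+n → cong (λ j → ℕ→ℚ (n C k) * (x ^ k * f j)) (ℕₚ.+-∸-assoc 1 (ℕₚ.≤-pred k<1+n)))) ⟨
  ∑ 0 (suc n) (λ k → ℕ→ℚ (n C k) * h (suc k)) + ∑ 0 (suc n) (λ k → ℕ→ℚ (n C k) * h k)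
    ≡⟨ ∑-pascal n h ⟨
  ∑ 0 (suc (suc n)) (λ k → ℕ→ℚ (suc n C k) * h k)
    ∎
  where
  h : ℕ → ℚ
  h k = x ^ k * f (suc n ∸ k)
  shuffle : ∀ x c p y → c * (x * p * y) ≡ x * (c * (p * y))
  shuffle = solve-∀ ring

appell-at-1 : ∀ (f : ℕ → ℚ) n → appell f n 1ℚ ≡ ∑ 0 (suc n) (λ k → ℕ→ℚ (n C k) * f k)
appell-at-1 f n = begin
  appell f n 1ℚ                                                   ≡⟨ appell-explicit f n 1ℚ ⟩
  ∑ 0 (suc n) (λ k → ℕ→ℚ (n C k) * (1ℚ ^ k * f (n ∸ k)))          ≡⟨ ∑-reverse (suc n) (λ k → ℕ→ℚ (n C k) * (1ℚ ^ k * f (n ∸ k))) ⟩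
  ∑ 0 (suc n) (λ k → ℕ→ℚ (n C (n ∸ k)) * (1ℚ ^ (n ∸ k) * f (n ∸ (n ∸ k))))
    ≡⟨ ∑-cong 0 (suc n) (λ k k<1+n → reflect k (ℕₚ.≤-pred k<1+n)) ⟩
  ∑ 0 (suc n) (λ k → ℕ→ℚ (n C k) * f k)                           ∎
  where
  reflect : ∀ k → k ≤ n → ℕ→ℚ (n C (n ∸ k)) * (1ℚ ^ (n ∸ k) * f (n ∸ (n ∸ k))) ≡ ℕ→ℚ (n C k) * f k
  reflect k k≤n = cong₂ _*_ (cong ℕ→ℚ (sym (nCk≡nC[n∸k] k≤n)))
                            (trans (cong (_* f (n ∸ (n ∸ k))) (1^k≡1 (n ∸ k)))
                                   (trans (ℚ.*-identityˡ _) (cong f (ℕₚ.m∸[m∸n]≡n k≤n))))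

coeff : (ℕ → ℚ) → ℕ → ℕ → ℚ
coeff f K k = ℕ→ℚ (K C k) * (sgn k * f (K ∸ k))

^-*-appell-neg : ∀ (f : ℕ → ℚ) K N y → y ^ N * appell f K (- y) ≡ ∑ 0 (suc K) (λ k → coeff f K k * y ^ (N ℕ.+ k))
^-*-appell-neg f K N y = begin
  y ^ N * appell f K (- y)
    ≡⟨ cong (y ^ N *_) (appell-explicit f K (- y)) ⟩
  y ^ N * ∑ 0 (suc K) (λ k → ℕ→ℚ (K C k) * ((- y) ^ k * f (K ∸ k)))
    ≡⟨ *-distribˡ-∑ (y ^ N) 0 (suc K) (λ k → ℕ→ℚ (K C k) * ((- y) ^ k * f (K ∸ k))) ⟩
  ∑ 0 (suc K) (λ k → y ^ N * (ℕ→ℚ (K C k) * ((- y) ^ k * f (K ∸ k))))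
    ≡⟨ ∑-cong 0 (suc K) (λ k _ → term k) ⟩
  ∑ 0 (suc K) (λ k → coeff f K k * y ^ (N ℕ.+ k))
    ∎
  where
  term : ∀ k → y ^ N * (ℕ→ℚ (K C k) * ((- y) ^ k * f (K ∸ k))) ≡ coeff f K k * y ^ (N ℕ.+ k)
  term k = begin
    y ^ N * (ℕ→ℚ (K C k) * ((- y) ^ k * f (K ∸ k)))        ≡⟨ cong (λ p → y ^ N * (ℕ→ℚ (K C k) * (p * f (K ∸ k)))) (neg-^ y k) ⟩
    y ^ N * (ℕ→ℚ (K C k) * (sgn k * y ^ k * f (K ∸ k)))    ≡⟨ regroup (y ^ N) (ℕ→ℚ (K C k)) (sgn k) (y ^ k) (f (K ∸ k)) ⟩
    coeff f K k * (y ^ N * y ^ k)                          ≡⟨ cong (coeff f K k *_) (^-distribˡ-+-* y N k) ⟨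
    coeff f K k * y ^ (N ℕ.+ k)                            ∎
    where
    regroup : ∀ p c s q v → p * (c * (s * q * v)) ≡ c * (s * v) * (p * q)
    regroup = solve-∀ ring

binomial+id-injective : ∀ d {u v : ℕ → ℚ} → (∀ k → k ≤ d → appell u k 1ℚ + u k ≡ appell v k 1ℚ + v k) →
                        ∀ k → k ≤ d → u k ≡ v k
binomial+id-injective d {u} {v} h = <-rec (λ k → k ≤ d → u k ≡ v k) step
  where
  D : ℕ → ℚ
  D i = u i - v i
  step : ∀ k → (∀ {i} → i < k → i ≤ d → u i ≡ v i) → k ≤ d → u k ≡ v k
  step k below k≤d = x-y≡0⇒x≡y (x+x≡0⇒x≡0 (begin
    D k + D k                                            ≡⟨ cong (_+ D k) (appell-below D k 1ℚ D-below) ⟨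
    appell D k 1ℚ + D k                                  ≡⟨ cong (_+ D k) (appell-- u v k 1ℚ) ⟩
    appell u k 1ℚ - appell v k 1ℚ + (u k - v k)          ≡⟨ regroup (appell u k 1ℚ) (appell v k 1ℚ) (u k) (v k) ⟩
    (appell u k 1ℚ + u k) - (appell v k 1ℚ + v k)        ≡⟨ cong (_- (appell v k 1ℚ + v k)) (h k k≤d) ⟩
    (appell v k 1ℚ + v k) - (appell v k 1ℚ + v k)        ≡⟨ ℚ.+-inverseʳ (appell v k 1ℚ + v k) ⟩
    0ℚ                                                   ∎))
    where
    D-below : ∀ i → i < k → D i ≡ 0ℚ
    D-below i i<k = trans (cong (_- v i) (below i<k (ℕₚ.≤-trans (ℕₚ.<⇒≤ i<k) k≤d))) (ℚ.+-inverseʳ (v i))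
    regroup : ∀ a b c e → a - b + (c - e) ≡ (a + c) - (b + e)
    regroup = solve-∀ ring

binomial-id-injective : ∀ {u v : ℕ → ℚ} → (∀ k → appell u k 1ℚ - u k ≡ appell v k 1ℚ - v k) → ∀ k → u k ≡ v k
binomial-id-injective {u} {v} h = <-rec (λ k → u k ≡ v k) step
  where
  D : ℕ → ℚ
  D i = u i - v i
  step : ∀ k → (∀ {i} → i < k → u i ≡ v i) → u k ≡ v k
  step k below = x-y≡0⇒x≡y (*-cancelˡ-ℕ→ℚ-suc k (begin
    ℕ→ℚ (suc k) * D k                                    ≡⟨ drop (ℕ→ℚ (suc k)) (D k) (D (suc k)) ⟩
    ℕ→ℚ (suc k) * (1ℚ * D k) + D (suc k) - D (suc k)     ≡⟨ cong (_- D (suc k)) (appell-below-suc D k 1ℚ D-below) ⟨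
    appell D (suc k) 1ℚ - D (suc k)                      ≡⟨ cong (_- D (suc k)) (appell-- u v (suc k) 1ℚ) ⟩
    appell u (suc k) 1ℚ - appell v (suc k) 1ℚ - (u (suc k) - v (suc k))
      ≡⟨ regroup (appell u (suc k) 1ℚ) (appell v (suc k) 1ℚ) (u (suc k)) (v (suc k)) ⟩
    (appell u (suc k) 1ℚ - u (suc k)) - (appell v (suc k) 1ℚ - v (suc k))
      ≡⟨ cong (_- (appell v (suc k) 1ℚ - v (suc k))) (h (suc k)) ⟩
    (appell v (suc k) 1ℚ - v (suc k)) - (appell v (suc k) 1ℚ - v (suc k))
      ≡⟨ ℚ.+-inverseʳ (appell v (suc k) 1ℚ - v (suc k)) ⟩
    0ℚ                                                   ≡⟨ ℚ.*-zeroʳ (ℕ→ℚ (suc k)) ⟨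
    ℕ→ℚ (suc k) * 0ℚ                                     ∎))
    where
    D-below : ∀ i → i < k → D i ≡ 0ℚ
    D-below i i<k = trans (cong (_- v i) (below i<k)) (ℚ.+-inverseʳ (v i))
    drop : ∀ n a b → n * a ≡ n * (1ℚ * a) + b - b
    drop = solve-∀ ring
    regroup : ∀ a b c e → a - b - (c - e) ≡ (a - c) - (b - e)
    regroup = solve-∀ ring

-- Bernoulli, Genocchi and Euler numbers

-- Defs computes bernoulli (suc m) from a private list of the earlier values, so these lemmas are
-- stated for an abstract listed m acc k (entry k of that list reversed onto acc) and its defining
-- equations. bernoulli-suc instantiates them by pattern unification once the seed list and _+_
-- have been with-abstracted from the unfolded goal.
module BernoulliList
  (listed : ℕ → List ℚ → ℕ → ℚ) (lookup : List ℚ → ℕ → ℚ)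
  (listed-zero : ∀ acc k → listed 0 acc k ≡ lookup acc k)
  (listed-suc : ∀ m acc k → listed (suc m) acc k ≡ listed m (bernoulli m ∷ acc) k)
  (lookup-head : ∀ x xs → lookup (x ∷ xs) 0 ≡ x)
  (lookup-tail : ∀ x xs k → lookup (x ∷ xs) (suc k) ≡ lookup xs k)
  where

  listed-beyond : ∀ m acc t → listed m acc (m ℕ.+ t) ≡ lookup acc t
  listed-beyond zero    acc t = listed-zero acc t
  listed-beyond (suc m) acc t = begin
    listed (suc m) acc (suc m ℕ.+ t)            ≡⟨ listed-suc m acc (suc m ℕ.+ t) ⟩
    listed m (bernoulli m ∷ acc) (suc m ℕ.+ t)  ≡⟨ cong (listed m (bernoulli m ∷ acc)) (ℕₚ.+-suc m t) ⟨
    listed m (bernoulli m ∷ acc) (m ℕ.+ suc t)  ≡⟨ listed-beyond m (bernoulli m ∷ acc) (suc t) ⟩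
    lookup (bernoulli m ∷ acc) (suc t)          ≡⟨ lookup-tail (bernoulli m) acc t ⟩
    lookup acc t                                ∎

  listed-top : ∀ m acc → listed m (bernoulli m ∷ acc) m ≡ bernoulli m
  listed-top m acc = begin
    listed m (bernoulli m ∷ acc) m          ≡⟨ cong (listed m (bernoulli m ∷ acc)) (ℕₚ.+-identityʳ m) ⟨
    listed m (bernoulli m ∷ acc) (m ℕ.+ 0)  ≡⟨ listed-beyond m (bernoulli m ∷ acc) 0 ⟩
    lookup (bernoulli m ∷ acc) 0            ≡⟨ lookup-head (bernoulli m) acc ⟩
    bernoulli m                             ∎

  listed-below : ∀ m acc k → k < m → listed m acc k ≡ bernoulli k
  listed-below (suc m) acc k (s≤s k≤m) with ℕₚ.m≤n⇒m<n∨m≡n k≤m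
  ... | inj₁ k<m  = trans (listed-suc m acc k) (listed-below m (bernoulli m ∷ acc) k k<m)
  ... | inj₂ refl = trans (listed-suc k acc k) (listed-top k acc)

  listed-bernoulli : ∀ m {acc} → bernoulli m ∷ [] ≡ acc → ∀ k → k ≤ m → listed m acc k ≡ bernoulli k
  listed-bernoulli m refl k k≤m with ℕₚ.m≤n⇒m<n∨m≡n k≤m
  ... | inj₁ k<m  = listed-below m (bernoulli m ∷ []) k k<m
  ... | inj₂ refl = listed-top k []

bernoulli-suc : ∀ m → bernoulli (suc m) ≡ - (recip (suc m) * ∑ 0 (suc m) (λ k → ℕ→ℚ (suc (suc m) C k) * bernoulli k))
bernoulli-suc with BernoulliList.listed-bernoulli _ _ (λ _ _ → refl) (λ _ _ _ → refl) (λ _ _ → refl) (λ _ _ _ → refl)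
... | entry = unfold
  where
  unfold : ∀ m → bernoulli (suc m) ≡ - (recip (suc m) * ∑ 0 (suc m) (λ k → ℕ→ℚ (suc (suc m) C k) * bernoulli k))
  unfold m with bernoulli m ∷ [] in eq | _+_
  ... | _ | add = cong₂ (λ b₀ s → - (recip (suc m) * add b₀ s))
    (cong (ℕ→ℚ (suc (suc m) C 0) *_) (entry m eq 0 z≤n))
    (trans (sumFromTo≡∑ 1 m _) (∑-cong 1 m (λ k k<1+m → cong (ℕ→ℚ (suc (suc m) C k) *_) (entry m eq k (ℕₚ.≤-pred k<1+m)))))

bernoulli-recurrence : ∀ m → ∑ 0 (suc (suc m)) (λ k → ℕ→ℚ (suc (suc m) C k) * bernoulli k) ≡ 0ℚ
bernoulli-recurrence m = begin
  ∑ 0 (suc (suc m)) F                               ≡⟨ ∑-snoc 0 (suc m) F ⟩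
  S + ℕ→ℚ (suc (suc m) C suc m) * bernoulli (suc m) ≡⟨ cong₂ (λ c b → S + ℕ→ℚ c * b) ([1+n]Cn≡1+n (suc m)) (bernoulli-suc m) ⟩
  S + ℕ→ℚ (suc (suc m)) * - (recip (suc m) * S)     ≡⟨ cancel S (ℕ→ℚ (suc (suc m))) (recip (suc m)) ⟩
  S - recip (suc m) * ℕ→ℚ (suc (suc m)) * S         ≡⟨ cong (λ c → S - c * S) (recip-inverse (suc m)) ⟩
  S - 1ℚ * S                                        ≡⟨ cong (λ a → S - a) (ℚ.*-identityˡ S) ⟩
  S - S                                             ≡⟨ ℚ.+-inverseʳ S ⟩
  0ℚ                                                ∎
  where
  F : ℕ → ℚ
  F k = ℕ→ℚ (suc (suc m) C k) * bernoulli k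
  S : ℚ
  S = ∑ 0 (suc m) F
  cancel : ∀ s n r → s + n * - (r * s) ≡ s - r * n * s
  cancel = solve-∀ ring

appell-bernoulli-1 : ∀ n → appell bernoulli n 1ℚ ≡ bernoulli n + δ₁ n
appell-bernoulli-1 zero          = sym (ℚ.+-identityʳ (bernoulli 0))
appell-bernoulli-1 (suc zero)    = refl
appell-bernoulli-1 (suc (suc m)) = begin
  appell bernoulli (suc (suc m)) 1ℚ                               ≡⟨ appell-at-1 bernoulli (suc (suc m)) ⟩
  ∑ 0 (suc (suc (suc m))) F                                       ≡⟨ ∑-snoc 0 (suc (suc m)) F ⟩
  ∑ 0 (suc (suc m)) F + ℕ→ℚ (suc (suc m) C suc (suc m)) * bernoulli (suc (suc m))
    ≡⟨ cong₂ (λ s c → s + ℕ→ℚ c * bernoulli (suc (suc m))) (bernoulli-recurrence m) (nCn≡1 (suc (suc m))) ⟩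
  0ℚ + 1ℚ * bernoulli (suc (suc m))                               ≡⟨ unit (bernoulli (suc (suc m))) ⟩
  bernoulli (suc (suc m)) + 0ℚ                                    ∎
  where
  F : ℕ → ℚ
  F k = ℕ→ℚ (suc (suc m) C k) * bernoulli k
  unit : ∀ b → 0ℚ + 1ℚ * b ≡ b + 0ℚ
  unit = solve-∀ ring

-- 2ⁿ(B_n(½) + B_n) = 2B_n.
bernoulli-duplication : ∀ n → appell (λ k → 2ℚ ^ k * bernoulli k) n 1ℚ + 2ℚ ^ n * bernoulli n ≡ 2ℚ * bernoulli n
bernoulli-duplication = binomial-id-injective {u} {λ k → 2ℚ * bernoulli k} λ k → trans (u-step k) (sym (v-step k))
  where
  c u : ℕ → ℚ
  c k = 2ℚ ^ k * bernoulli k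
  u k = appell c k 1ℚ + c k

  u-step : ∀ k → appell u k 1ℚ - u k ≡ 2ℚ * δ₁ k
  u-step k = begin
    appell u k 1ℚ - u k
      ≡⟨ cong (_- u k) (appell-+ (λ i → appell c i 1ℚ) c k 1ℚ) ⟩
    appell (λ i → appell c i 1ℚ) k 1ℚ + appell c k 1ℚ - u k
      ≡⟨ cong (λ a → a + appell c k 1ℚ - u k) (appell-appell c k 1ℚ 1ℚ) ⟩
    appell c k 2ℚ + appell c k 1ℚ - u k
      ≡⟨ cong (λ a → a + appell c k 1ℚ - u k) (trans (appell-scale 2ℚ bernoulli k 1ℚ) (cong (2ℚ ^ k *_) (appell-bernoulli-1 k))) ⟩
    2ℚ ^ k * (bernoulli k + δ₁ k) + appell c k 1ℚ - (appell c k 1ℚ + 2ℚ ^ k * bernoulli k)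
      ≡⟨ cancel (2ℚ ^ k) (bernoulli k) (δ₁ k) (appell c k 1ℚ) ⟩
    2ℚ ^ k * δ₁ k
      ≡⟨ ^-*-δ₁ 2ℚ k ⟩
    2ℚ * δ₁ k
      ∎
    where
    cancel : ∀ p b e a → p * (b + e) + a - (a + p * b) ≡ p * e
    cancel = solve-∀ ring

  v-step : ∀ k → appell (λ i → 2ℚ * bernoulli i) k 1ℚ - 2ℚ * bernoulli k ≡ 2ℚ * δ₁ k
  v-step k = begin
    appell (λ i → 2ℚ * bernoulli i) k 1ℚ - 2ℚ * bernoulli k  ≡⟨ cong (_- 2ℚ * bernoulli k) (appell-* 2ℚ bernoulli k 1ℚ) ⟩
    2ℚ * appell bernoulli k 1ℚ - 2ℚ * bernoulli k           ≡⟨ cong (λ a → 2ℚ * a - 2ℚ * bernoulli k) (appell-bernoulli-1 k) ⟩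
    2ℚ * (bernoulli k + δ₁ k) - 2ℚ * bernoulli k            ≡⟨ cancel (bernoulli k) (δ₁ k) ⟩
    2ℚ * δ₁ k                                               ∎
    where
    cancel : ∀ b e → 2ℚ * (b + e) - 2ℚ * b ≡ 2ℚ * e
    cancel = solve-∀ ring

-- Halved Genocchi numbers; halfEuler k = E_k(0)/2 for the Euler polynomial E_k.
halfGenocchi : ℕ → ℚ
halfGenocchi k = (1ℚ - pow2 k) * bernoulli k

halfEuler : ℕ → ℚ
halfEuler k = halfGenocchi (suc k) * recip k

halfGenocchi≡zMul-halfEuler : ∀ k → halfGenocchi k ≡ zMul halfEuler k
halfGenocchi≡zMul-halfEuler zero    = refl
halfGenocchi≡zMul-halfEuler (suc k) = begin
  halfGenocchi (suc k)                                  ≡⟨ ℚ.*-identityʳ (halfGenocchi (suc k)) ⟨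
  halfGenocchi (suc k) * 1ℚ                             ≡⟨ cong (halfGenocchi (suc k) *_) (recip-inverse k) ⟨
  halfGenocchi (suc k) * (recip k * ℕ→ℚ (suc k))         ≡⟨ regroup (halfGenocchi (suc k)) (recip k) (ℕ→ℚ (suc k)) ⟩
  ℕ→ℚ (suc k) * (halfGenocchi (suc k) * recip k)         ∎
  where
  regroup : ∀ g r n → g * (r * n) ≡ n * (g * r)
  regroup = solve-∀ ring

halfGenocchi-recurrence : ∀ n → appell halfGenocchi n 1ℚ + halfGenocchi n ≡ δ₁ n
halfGenocchi-recurrence n = begin
  appell halfGenocchi n 1ℚ + halfGenocchi n
    ≡⟨ cong₂ _+_ (trans (appell-cong n 1ℚ (λ k _ → genocchi-split k)) (appell-- bernoulli c n 1ℚ)) (genocchi-split n) ⟩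
  (appell bernoulli n 1ℚ - appell c n 1ℚ) + (bernoulli n - c n)
    ≡⟨ cong (λ a → (a - appell c n 1ℚ) + (bernoulli n - c n)) (appell-bernoulli-1 n) ⟩
  (bernoulli n + δ₁ n - appell c n 1ℚ) + (bernoulli n - c n)
    ≡⟨ regroup (bernoulli n) (δ₁ n) (appell c n 1ℚ) (c n) ⟩
  2ℚ * bernoulli n + δ₁ n - (appell c n 1ℚ + c n)
    ≡⟨ cong (λ a → 2ℚ * bernoulli n + δ₁ n - a) (bernoulli-duplication n) ⟩
  2ℚ * bernoulli n + δ₁ n - 2ℚ * bernoulli n
    ≡⟨ cancel (bernoulli n) (δ₁ n) ⟩
  δ₁ n
    ∎
  where
  c : ℕ → ℚ
  c k = 2ℚ ^ k * bernoulli k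
  genocchi-split : ∀ k → halfGenocchi k ≡ bernoulli k - c k
  genocchi-split k = trans (cong (λ p → (1ℚ - p) * bernoulli k) (pow2≡2^ k)) (distrib (2ℚ ^ k) (bernoulli k))
    where
    distrib : ∀ p b → (1ℚ - p) * b ≡ b - p * b
    distrib = solve-∀ ring
  regroup : ∀ b e a c → (b + e - a) + (b - c) ≡ 2ℚ * b + e - (a + c)
  regroup = solve-∀ ring
  cancel : ∀ b e → 2ℚ * b + e - 2ℚ * b ≡ e
  cancel = solve-∀ ring

halfEuler-recurrence : ∀ n → appell halfEuler n 1ℚ + halfEuler n ≡ δ₀ n
halfEuler-recurrence n = *-cancelˡ-ℕ→ℚ-suc n (begin
  ℕ→ℚ (suc n) * (appell halfEuler n 1ℚ + halfEuler n)
    ≡⟨ ℚ.*-distribˡ-+ (ℕ→ℚ (suc n)) (appell halfEuler n 1ℚ) (halfEuler n) ⟩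
  ℕ→ℚ (suc n) * appell halfEuler n 1ℚ + ℕ→ℚ (suc n) * halfEuler n
    ≡⟨ cong (_+ ℕ→ℚ (suc n) * halfEuler n) (appell-zMul halfEuler n 1ℚ) ⟨
  appell (zMul halfEuler) (suc n) 1ℚ + zMul halfEuler (suc n)
    ≡⟨ cong₂ _+_ (appell-cong (suc n) 1ℚ (λ k _ → halfGenocchi≡zMul-halfEuler k)) (halfGenocchi≡zMul-halfEuler (suc n)) ⟨
  appell halfGenocchi (suc n) 1ℚ + halfGenocchi (suc n)
    ≡⟨ halfGenocchi-recurrence (suc n) ⟩
  δ₀ n
    ≡⟨ δ₀≡[1+n]*δ₀ n ⟩
  ℕ→ℚ (suc n) * δ₀ n
    ∎)
  where
  δ₀≡[1+n]*δ₀ : ∀ n → δ₀ n ≡ ℕ→ℚ (suc n) * δ₀ n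
  δ₀≡[1+n]*δ₀ zero    = refl
  δ₀≡[1+n]*δ₀ (suc n) = sym (ℚ.*-zeroʳ (ℕ→ℚ (suc (suc n))))

appell-halfEuler-−1 : ∀ n → appell halfEuler n (- 1ℚ) ≡ sgn n - halfEuler n
appell-halfEuler-−1 n = x+y≡z⇒y≡z-x (sym (begin
  sgn n                                                 ≡⟨ ℚ.*-identityʳ (sgn n) ⟨
  sgn n * 1ℚ                                            ≡⟨ cong (sgn n *_) (1^k≡1 n) ⟨
  sgn n * 1ℚ ^ n                                        ≡⟨ trans (appell-δ₀ n (- 1ℚ)) (neg-^ 1ℚ n) ⟨
  appell δ₀ n (- 1ℚ)                                    ≡⟨ appell-cong n (- 1ℚ) (λ k _ → halfEuler-recurrence k) ⟨
  appell (λ k → appell halfEuler k 1ℚ + halfEuler k) n (- 1ℚ)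
    ≡⟨ appell-+ (λ k → appell halfEuler k 1ℚ) halfEuler n (- 1ℚ) ⟩
  appell (λ k → appell halfEuler k 1ℚ) n (- 1ℚ) + A     ≡⟨ cong (_+ A) (appell-appell halfEuler n (- 1ℚ) 1ℚ) ⟩
  appell halfEuler n 0ℚ + A                             ≡⟨ cong (_+ A) (appell-0 halfEuler n) ⟩
  halfEuler n + A                                       ∎))
  where
  A : ℚ
  A = appell halfEuler n (- 1ℚ)

appell-halfEuler-1 : ∀ n → appell halfEuler n 1ℚ ≡ sgn n * halfEuler n
appell-halfEuler-1 n = binomial+id-injective n {λ k → appell halfEuler k 1ℚ} {λ k → sgn k * halfEuler k}
  (λ k _ → trans (shifted-sum k) (sym (signed-sum k))) n ℕₚ.≤-refl
  where
  shifted-sum : ∀ k → appell (λ i → appell halfEuler i 1ℚ) k 1ℚ + appell halfEuler k 1ℚ ≡ 1ℚ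
  shifted-sum k = begin
    appell (λ i → appell halfEuler i 1ℚ) k 1ℚ + appell halfEuler k 1ℚ
      ≡⟨ appell-+ (λ i → appell halfEuler i 1ℚ) halfEuler k 1ℚ ⟨
    appell (λ i → appell halfEuler i 1ℚ + halfEuler i) k 1ℚ
      ≡⟨ appell-cong k 1ℚ (λ i _ → halfEuler-recurrence i) ⟩
    appell δ₀ k 1ℚ
      ≡⟨ trans (appell-δ₀ k 1ℚ) (1^k≡1 k) ⟩
    1ℚ
      ∎
  signed-sum : ∀ k → appell (λ i → sgn i * halfEuler i) k 1ℚ + sgn k * halfEuler k ≡ 1ℚ
  signed-sum k = begin
    appell (λ i → sgn i * halfEuler i) k 1ℚ + sgn k * halfEuler k
      ≡⟨ cong (_+ sgn k * halfEuler k) (trans (appell-sgn halfEuler k 1ℚ) (cong (sgn k *_) (appell-halfEuler-−1 k))) ⟩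
    sgn k * (sgn k - halfEuler k) + sgn k * halfEuler k
      ≡⟨ regroup (sgn k) (halfEuler k) ⟩
    sgn k * (sgn k * 1ℚ)
      ≡⟨ sgn-cancel k 1ℚ ⟩
    1ℚ
      ∎
    where
    regroup : ∀ s e → s * (s - e) + s * e ≡ s * (s * 1ℚ)
    regroup = solve-∀ ring

-- Finite differences and the Euler functional

Δ : (ℚ → ℚ) → ℚ → ℚ
Δ p x = p (x + 1ℚ) - p x

data Deg≤ : ℕ → (ℚ → ℚ) → Set where
  constant : ∀ {p} → (∀ x → Δ p x ≡ 0ℚ) → Deg≤ 0 p
  Δ-Deg≤   : ∀ {d p} → Deg≤ d (Δ p) → Deg≤ (suc d) p

-- ℰ d p = ½ Σ_{j≤d} (-½)ʲ (Δʲp)(0), which is ((2 + Δ)⁻¹p)(0) when Deg≤ d p; here (2 + Δ)p = p(x+1) + p(x).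
ℰ : ℕ → (ℚ → ℚ) → ℚ
ℰ zero    p = ½ * p 0ℚ
ℰ (suc d) p = ½ * (p 0ℚ - ℰ d (Δ p))

Δ-cong : ∀ {p q : ℚ → ℚ} → (∀ x → p x ≡ q x) → ∀ x → Δ p x ≡ Δ q x
Δ-cong h x = cong₂ _-_ (h (x + 1ℚ)) (h x)

Δ-linear : ∀ a b (p q : ℚ → ℚ) x → Δ (λ y → a * p y + b * q y) x ≡ a * Δ p x + b * Δ q x
Δ-linear a b p q x = distrib a b (p (x + 1ℚ)) (p x) (q (x + 1ℚ)) (q x)
  where
  distrib : ∀ a b p₁ p₀ q₁ q₀ → a * p₁ + b * q₁ - (a * p₀ + b * q₀) ≡ a * (p₁ - p₀) + b * (q₁ - q₀)
  distrib = solve-∀ ring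

Δ-* : ∀ (p q : ℚ → ℚ) x → Δ (λ y → p y * q y) x ≡ Δ p x * q (x + 1ℚ) + p x * Δ q x
Δ-* p q x = leibniz (p (x + 1ℚ)) (p x) (q (x + 1ℚ)) (q x)
  where
  leibniz : ∀ p₁ p₀ q₁ q₀ → p₁ * q₁ - p₀ * q₀ ≡ (p₁ - p₀) * q₁ + p₀ * (q₁ - q₀)
  leibniz = solve-∀ ring

Deg≤-cong : ∀ {d} {p q : ℚ → ℚ} → (∀ x → p x ≡ q x) → Deg≤ d p → Deg≤ d q
Deg≤-cong h (constant dp) = constant (λ x → trans (sym (Δ-cong h x)) (dp x))
Deg≤-cong h (Δ-Deg≤ dp)   = Δ-Deg≤ (Deg≤-cong (Δ-cong h) dp)

Deg≤-linear : ∀ {d} a b {p q : ℚ → ℚ} → Deg≤ d p → Deg≤ d q → Deg≤ d (λ x → a * p x + b * q x)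
Deg≤-linear a b {p} {q} (constant dp) (constant dq) = constant λ x → begin
  Δ (λ y → a * p y + b * q y) x   ≡⟨ Δ-linear a b p q x ⟩
  a * Δ p x + b * Δ q x           ≡⟨ cong₂ (λ s t → a * s + b * t) (dp x) (dq x) ⟩
  a * 0ℚ + b * 0ℚ                 ≡⟨ vanish a b ⟩
  0ℚ                              ∎
  where
  vanish : ∀ a b → a * 0ℚ + b * 0ℚ ≡ 0ℚ
  vanish = solve-∀ ring
Deg≤-linear a b {p} {q} (Δ-Deg≤ dp) (Δ-Deg≤ dq) =
  Δ-Deg≤ (Deg≤-cong (λ x → sym (Δ-linear a b p q x)) (Deg≤-linear a b dp dq))

Deg≤-+ : ∀ {d} {p q : ℚ → ℚ} → Deg≤ d p → Deg≤ d q → Deg≤ d (λ x → p x + q x)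
Deg≤-+ {p = p} {q} dp dq = Deg≤-cong (λ x → cong₂ _+_ (ℚ.*-identityˡ (p x)) (ℚ.*-identityˡ (q x))) (Deg≤-linear 1ℚ 1ℚ dp dq)

Deg≤-const : ∀ c → Deg≤ 0 (λ _ → c)
Deg≤-const c = constant (λ _ → ℚ.+-inverseʳ c)

Deg≤-suc : ∀ {d} {p : ℚ → ℚ} → Deg≤ d p → Deg≤ (suc d) p
Deg≤-suc (constant dp) = Δ-Deg≤ (constant (λ x → trans (cong₂ _-_ (dp (x + 1ℚ)) (dp x)) (ℚ.+-inverseʳ 0ℚ)))
Deg≤-suc (Δ-Deg≤ dp)   = Δ-Deg≤ (Deg≤-suc dp)

Deg≤-weaken : ∀ {a d} {p : ℚ → ℚ} → a ≤ d → Deg≤ a p → Deg≤ d p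
Deg≤-weaken {d = zero}  z≤n       dp          = dp
Deg≤-weaken {d = suc d} z≤n       dp          = Deg≤-suc (Deg≤-weaken z≤n dp)
Deg≤-weaken             (s≤s a≤d) (Δ-Deg≤ dp) = Δ-Deg≤ (Deg≤-weaken a≤d dp)

Deg≤-shift : ∀ {d} c {p : ℚ → ℚ} → Deg≤ d p → Deg≤ d (λ x → p (x + c))
Deg≤-shift c {p} (constant dp) = constant (λ x → trans (Δ-shift x) (dp (x + c)))
  where
  Δ-shift : ∀ x → Δ (λ y → p (y + c)) x ≡ Δ p (x + c)
  Δ-shift x = cong (λ y → p y - p (x + c)) (commute x c)
    where
    commute : ∀ x c → x + 1ℚ + c ≡ x + c + 1ℚ
    commute = solve-∀ ring
Deg≤-shift c {p} (Δ-Deg≤ dp) = Δ-Deg≤ (Deg≤-cong (λ x → cong (λ y → p y - p (x + c)) (commute x c)) (Deg≤-shift c dp))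
  where
  commute : ∀ x c → x + c + 1ℚ ≡ x + 1ℚ + c
  commute = solve-∀ ring

Deg≤-* : ∀ {a b} {p q : ℚ → ℚ} → Deg≤ a p → Deg≤ b q → Deg≤ (a ℕ.+ b) (λ x → p x * q x)
Deg≤-* {p = p} {q} (constant dp) (constant dq) = constant λ x → begin
  Δ (λ y → p y * q y) x                  ≡⟨ Δ-* p q x ⟩
  Δ p x * q (x + 1ℚ) + p x * Δ q x       ≡⟨ cong₂ (λ s t → s * q (x + 1ℚ) + p x * t) (dp x) (dq x) ⟩
  0ℚ * q (x + 1ℚ) + p x * 0ℚ             ≡⟨ vanish (q (x + 1ℚ)) (p x) ⟩
  0ℚ                                     ∎
  where
  vanish : ∀ s t → 0ℚ * s + t * 0ℚ ≡ 0ℚ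
  vanish = solve-∀ ring
Deg≤-* {p = p} {q} p-const@(constant dp) (Δ-Deg≤ dq) = Δ-Deg≤ (Deg≤-cong leibniz (Deg≤-* p-const dq))
  where
  leibniz : ∀ x → p x * Δ q x ≡ Δ (λ y → p y * q y) x
  leibniz x = sym (trans (Δ-* p q x) (trans (cong (λ s → s * q (x + 1ℚ) + p x * Δ q x) (dp x))
                                            (drop (q (x + 1ℚ)) (p x * Δ q x))))
    where
    drop : ∀ s t → 0ℚ * s + t ≡ t
    drop = solve-∀ ring
Deg≤-* {p = p} {q} (Δ-Deg≤ dp) q-const@(constant dq) = Δ-Deg≤ (Deg≤-cong leibniz (Deg≤-* dp (Deg≤-shift 1ℚ q-const)))
  where
  leibniz : ∀ x → Δ p x * q (x + 1ℚ) ≡ Δ (λ y → p y * q y) x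
  leibniz x = sym (trans (Δ-* p q x) (trans (cong (λ t → Δ p x * q (x + 1ℚ) + p x * t) (dq x))
                                            (drop (Δ p x * q (x + 1ℚ)) (p x))))
    where
    drop : ∀ s t → s + t * 0ℚ ≡ s
    drop = solve-∀ ring
Deg≤-* {suc a} {suc b} {p} {q} p-deg@(Δ-Deg≤ dp) q-deg@(Δ-Deg≤ dq) = Δ-Deg≤ (Deg≤-cong (λ x → sym (Δ-* p q x))
  (Deg≤-+ (Deg≤-* dp (Deg≤-shift 1ℚ q-deg))
          (subst (λ e → Deg≤ e (λ x → p x * Δ q x)) (sym (ℕₚ.+-suc a b)) (Deg≤-* p-deg dq))))

Deg≤-^ : ∀ k → Deg≤ k (λ x → x ^ k)
Deg≤-^ zero    = Deg≤-const 1ℚ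
Deg≤-^ (suc k) = Deg≤-* id-linear (Deg≤-^ k)
  where
  id-linear : Deg≤ 1 (λ x → x)
  id-linear = Δ-Deg≤ (constant second-difference)
    where
    second-difference : ∀ x → x + 1ℚ + 1ℚ - (x + 1ℚ) - (x + 1ℚ - x) ≡ 0ℚ
    second-difference = solve-∀ ring

Deg≤-appell-neg : ∀ (f : ℕ → ℚ) n → Deg≤ n (λ x → appell f n (- x))
Deg≤-appell-neg f zero    = Deg≤-const (f 0)
Deg≤-appell-neg f (suc n) = Deg≤-+ (Deg≤-* neg-linear (Deg≤-appell-neg f n)) (Deg≤-suc (Deg≤-appell-neg (f ∘ suc) n))
  where
  neg-linear : Deg≤ 1 (λ x → - x)
  neg-linear = Δ-Deg≤ (constant second-difference)
    where
    second-difference : ∀ x → - (x + 1ℚ + 1ℚ) - - (x + 1ℚ) - (- (x + 1ℚ) - - x) ≡ 0ℚ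
    second-difference = solve-∀ ring

ℰ-cong : ∀ d {p q : ℚ → ℚ} → (∀ x → p x ≡ q x) → ℰ d p ≡ ℰ d q
ℰ-cong zero    h = cong (½ *_) (h 0ℚ)
ℰ-cong (suc d) h = cong₂ (λ a b → ½ * (a - b)) (h 0ℚ) (ℰ-cong d (Δ-cong h))

ℰ-linear : ∀ d a b (p q : ℚ → ℚ) → ℰ d (λ x → a * p x + b * q x) ≡ a * ℰ d p + b * ℰ d q
ℰ-linear zero    a b p q = distrib a b (p 0ℚ) (q 0ℚ)
  where
  distrib : ∀ a b s t → ½ * (a * s + b * t) ≡ a * (½ * s) + b * (½ * t)
  distrib = solve-∀ ring
ℰ-linear (suc d) a b p q = begin
  ½ * ((a * p 0ℚ + b * q 0ℚ) - ℰ d (Δ (λ x → a * p x + b * q x)))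
    ≡⟨ cong (λ e → ½ * ((a * p 0ℚ + b * q 0ℚ) - e)) (trans (ℰ-cong d (Δ-linear a b p q)) (ℰ-linear d a b (Δ p) (Δ q))) ⟩
  ½ * ((a * p 0ℚ + b * q 0ℚ) - (a * ℰ d (Δ p) + b * ℰ d (Δ q)))
    ≡⟨ distrib a b (p 0ℚ) (q 0ℚ) (ℰ d (Δ p)) (ℰ d (Δ q)) ⟩
  a * (½ * (p 0ℚ - ℰ d (Δ p))) + b * (½ * (q 0ℚ - ℰ d (Δ q)))
    ∎
  where
  distrib : ∀ a b s t u v → ½ * ((a * s + b * t) - (a * u + b * v)) ≡ a * (½ * (s - u)) + b * (½ * (t - v))
  distrib = solve-∀ ring

ℰ-+ : ∀ d (p q : ℚ → ℚ) → ℰ d (λ x → p x + q x) ≡ ℰ d p + ℰ d q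
ℰ-+ d p q = begin
  ℰ d (λ x → p x + q x)            ≡⟨ ℰ-cong d (λ x → cong₂ _+_ (ℚ.*-identityˡ (p x)) (ℚ.*-identityˡ (q x))) ⟨
  ℰ d (λ x → 1ℚ * p x + 1ℚ * q x)  ≡⟨ ℰ-linear d 1ℚ 1ℚ p q ⟩
  1ℚ * ℰ d p + 1ℚ * ℰ d q          ≡⟨ cong₂ _+_ (ℚ.*-identityˡ (ℰ d p)) (ℚ.*-identityˡ (ℰ d q)) ⟩
  ℰ d p + ℰ d q                    ∎

ℰ-- : ∀ d (p q : ℚ → ℚ) → ℰ d (λ x → p x - q x) ≡ ℰ d p - ℰ d q
ℰ-- d p q = begin
  ℰ d (λ x → p x - q x)              ≡⟨ ℰ-cong d (λ x → as-combination (p x) (q x)) ⟩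
  ℰ d (λ x → 1ℚ * p x + - 1ℚ * q x)  ≡⟨ ℰ-linear d 1ℚ (- 1ℚ) p q ⟩
  1ℚ * ℰ d p + - 1ℚ * ℰ d q          ≡⟨ as-combination (ℰ d p) (ℰ d q) ⟨
  ℰ d p - ℰ d q                      ∎
  where
  as-combination : ∀ s t → s - t ≡ 1ℚ * s + - 1ℚ * t
  as-combination = solve-∀ ring

ℰ-* : ∀ d c (p : ℚ → ℚ) → ℰ d (λ x → c * p x) ≡ c * ℰ d p
ℰ-* d c p = begin
  ℰ d (λ x → c * p x)               ≡⟨ ℰ-cong d (λ x → pad c (p x)) ⟩
  ℰ d (λ x → c * p x + 0ℚ * p x)    ≡⟨ ℰ-linear d c 0ℚ p p ⟩
  c * ℰ d p + 0ℚ * ℰ d p            ≡⟨ pad c (ℰ d p) ⟨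
  c * ℰ d p                         ∎
  where
  pad : ∀ c s → c * s ≡ c * s + 0ℚ * s
  pad = solve-∀ ring

ℰ-∑ : ∀ d i r (F : ℕ → ℚ → ℚ) → ℰ d (λ x → ∑ i r (λ k → F k x)) ≡ ∑ i r (λ k → ℰ d (F k))
ℰ-∑ d i zero    F = trans (ℰ-* d 0ℚ (λ _ → 0ℚ)) (ℚ.*-zeroˡ (ℰ d (λ _ → 0ℚ)))
ℰ-∑ d i (suc r) F = trans (ℰ-+ d (F i) (λ x → ∑ (suc i) r (λ k → F k x))) (cong (ℰ d (F i) +_) (ℰ-∑ d (suc i) r F))

ℰ-appell : ∀ d (F : ℕ → ℚ → ℚ) n a → ℰ d (λ x → appell (λ k → F k x) n a) ≡ appell (λ k → ℰ d (F k)) n a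
ℰ-appell d F zero    a = refl
ℰ-appell d F (suc n) a = begin
  ℰ d (λ x → a * appell (λ k → F k x) n a + appell (λ k → F (suc k) x) n a)
    ≡⟨ ℰ-+ d (λ x → a * appell (λ k → F k x) n a) (λ x → appell (λ k → F (suc k) x) n a) ⟩
  ℰ d (λ x → a * appell (λ k → F k x) n a) + ℰ d (λ x → appell (λ k → F (suc k) x) n a)
    ≡⟨ cong₂ _+_ (trans (ℰ-* d a (λ x → appell (λ k → F k x) n a)) (cong (a *_) (ℰ-appell d F n a)))
                 (ℰ-appell d (F ∘ suc) n a) ⟩
  a * appell (λ k → ℰ d (F k)) n a + appell (λ k → ℰ d (F (suc k))) n a
    ∎

ℰ[p+1]+ℰ[p]≡p[0] : ∀ {d} {p : ℚ → ℚ} → Deg≤ d p → ℰ d (λ x → p (x + 1ℚ)) + ℰ d p ≡ p 0ℚ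
ℰ[p+1]+ℰ[p]≡p[0] {p = p} (constant dp) = begin
  ½ * p 1ℚ + ½ * p 0ℚ        ≡⟨ split (p 1ℚ) (p 0ℚ) ⟩
  p 0ℚ + ½ * Δ p 0ℚ          ≡⟨ cong (λ e → p 0ℚ + ½ * e) (dp 0ℚ) ⟩
  p 0ℚ + ½ * 0ℚ              ≡⟨ vanish (p 0ℚ) ⟩
  p 0ℚ                       ∎
  where
  split : ∀ s t → ½ * s + ½ * t ≡ t + ½ * (s - t)
  split = solve-∀ ring
  vanish : ∀ t → t + ½ * 0ℚ ≡ t
  vanish = solve-∀ ring
ℰ[p+1]+ℰ[p]≡p[0] {suc d} {p} (Δ-Deg≤ dp) = begin
  ½ * (p 1ℚ - ℰ d (λ x → Δ p (x + 1ℚ))) + ½ * (p 0ℚ - ℰ d (Δ p))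
    ≡⟨ regroup (p 1ℚ) (p 0ℚ) (ℰ d (λ x → Δ p (x + 1ℚ))) (ℰ d (Δ p)) ⟩
  ½ * (p 1ℚ + p 0ℚ) - ½ * (ℰ d (λ x → Δ p (x + 1ℚ)) + ℰ d (Δ p))
    ≡⟨ cong (λ e → ½ * (p 1ℚ + p 0ℚ) - ½ * e) (ℰ[p+1]+ℰ[p]≡p[0] dp) ⟩
  ½ * (p 1ℚ + p 0ℚ) - ½ * (p 1ℚ - p 0ℚ)
    ≡⟨ cancel (p 1ℚ) (p 0ℚ) ⟩
  p 0ℚ
    ∎
  where
  regroup : ∀ s t u v → ½ * (s - u) + ½ * (t - v) ≡ ½ * (s + t) - ½ * (u + v)
  regroup = solve-∀ ring
  cancel : ∀ s t → ½ * (s + t) - ½ * (s - t) ≡ t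
  cancel = solve-∀ ring

ℰ-binomial : ∀ d k → ℰ d (λ x → (x + 1ℚ) ^ k) ≡ appell (λ i → ℰ d (λ x → x ^ i)) k 1ℚ
ℰ-binomial d k = begin
  ℰ d (λ x → (x + 1ℚ) ^ k)                ≡⟨ ℰ-cong d (λ x → trans (cong (_^ k) (ℚ.+-comm x 1ℚ)) (sym (appell-pow k 1ℚ x))) ⟩
  ℰ d (λ x → appell (λ i → x ^ i) k 1ℚ)    ≡⟨ ℰ-appell d (λ i x → x ^ i) k 1ℚ ⟩
  appell (λ i → ℰ d (λ x → x ^ i)) k 1ℚ    ∎

ℰ-monomial : ∀ d k → k ≤ d → ℰ d (λ x → x ^ k) ≡ halfEuler k
ℰ-monomial d = binomial+id-injective d (λ k k≤d → trans (moment-recurrence k k≤d) (sym (halfEuler-recurrence k)))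
  where
  moment-recurrence : ∀ k → k ≤ d → appell (λ i → ℰ d (λ x → x ^ i)) k 1ℚ + ℰ d (λ x → x ^ k) ≡ δ₀ k
  moment-recurrence k k≤d = begin
    appell (λ i → ℰ d (λ x → x ^ i)) k 1ℚ + ℰ d (λ x → x ^ k)   ≡⟨ cong (_+ ℰ d (λ x → x ^ k)) (ℰ-binomial d k) ⟨
    ℰ d (λ x → (x + 1ℚ) ^ k) + ℰ d (λ x → x ^ k)                ≡⟨ ℰ[p+1]+ℰ[p]≡p[0] (Deg≤-weaken k≤d (Deg≤-^ k)) ⟩
    0ℚ ^ k                                                       ≡⟨ 0^k≡δ₀ k ⟩
    δ₀ k                                                         ∎

ℰ-shifted-monomial : ∀ d k → k ≤ d → ℰ d (λ x → (x + 1ℚ) ^ k) ≡ sgn k * halfEuler k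
ℰ-shifted-monomial d k k≤d = begin
  ℰ d (λ x → (x + 1ℚ) ^ k)                ≡⟨ ℰ-binomial d k ⟩
  appell (λ i → ℰ d (λ x → x ^ i)) k 1ℚ    ≡⟨ appell-cong k 1ℚ (λ i i≤k → ℰ-monomial d i (ℕₚ.≤-trans i≤k k≤d)) ⟩
  appell halfEuler k 1ℚ                    ≡⟨ appell-halfEuler-1 k ⟩
  sgn k * halfEuler k                      ∎

ℰ-reflected-monomial : ∀ d k → k ≤ d → ℰ d (λ x → (- 1ℚ - x) ^ k) ≡ halfEuler k
ℰ-reflected-monomial d k k≤d = begin
  ℰ d (λ x → (- 1ℚ - x) ^ k)             ≡⟨ ℰ-cong d (λ x → trans (cong (_^ k) (negate x)) (neg-^ (x + 1ℚ) k)) ⟩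
  ℰ d (λ x → sgn k * (x + 1ℚ) ^ k)        ≡⟨ ℰ-* d (sgn k) (λ x → (x + 1ℚ) ^ k) ⟩
  sgn k * ℰ d (λ x → (x + 1ℚ) ^ k)        ≡⟨ cong (sgn k *_) (ℰ-shifted-monomial d k k≤d) ⟩
  sgn k * (sgn k * halfEuler k)           ≡⟨ sgn-cancel k (halfEuler k) ⟩
  halfEuler k                             ∎
  where
  negate : ∀ x → - 1ℚ - x ≡ - (x + 1ℚ)
  negate = solve-∀ ring

ℰ-^-*-appell-neg : ∀ d (ψ : ℚ → ℚ) → (∀ k → k ≤ d → ℰ d (λ x → ψ x ^ k) ≡ halfEuler k) →
                   ∀ f K N → N ℕ.+ K ≤ d →
                   ℰ d (λ x → ψ x ^ N * appell f K (- ψ x)) ≡ ∑ 0 (suc K) (λ k → coeff f K k * halfEuler (N ℕ.+ k))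
ℰ-^-*-appell-neg d ψ ℰ-ψ^ f K N N+K≤d = begin
  ℰ d (λ x → ψ x ^ N * appell f K (- ψ x))
    ≡⟨ ℰ-cong d (λ x → ^-*-appell-neg f K N (ψ x)) ⟩
  ℰ d (λ x → ∑ 0 (suc K) (λ k → coeff f K k * ψ x ^ (N ℕ.+ k)))
    ≡⟨ ℰ-∑ d 0 (suc K) (λ k x → coeff f K k * ψ x ^ (N ℕ.+ k)) ⟩
  ∑ 0 (suc K) (λ k → ℰ d (λ x → coeff f K k * ψ x ^ (N ℕ.+ k)))
    ≡⟨ ∑-cong 0 (suc K) (λ k k<1+K → trans (ℰ-* d (coeff f K k) (λ x → ψ x ^ (N ℕ.+ k)))
                                          (cong (coeff f K k *_) (ℰ-ψ^ (N ℕ.+ k) (N+k≤d k (ℕₚ.≤-pred k<1+K))))) ⟩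
  ∑ 0 (suc K) (λ k → coeff f K k * halfEuler (N ℕ.+ k))
    ∎
  where
  N+k≤d : ∀ k → k ≤ K → N ℕ.+ k ≤ d
  N+k≤d k k≤K = ℕₚ.≤-trans (ℕₚ.+-monoʳ-≤ N k≤K) N+K≤d

cancel-signs : ∀ {s t X Y E c} → s * s ≡ 1ℚ →
               s * Y + t * s * E - t * X ≡ s * c →
               s * (t * s * E) - t * s * X + X ≡ c →
               X ≡ Y
cancel-signs {s} {t} {X} {Y} {E} {c} s²≡1 first second = x-y≡0⇒x≡y (begin
  X - Y
    ≡⟨ combine s t X Y E c ⟩
  (s * (t * s * E) - t * s * X + X - c) - s * (s * Y + t * s * E - t * X - s * c) + (s * s - 1ℚ) * (Y - c)
    ≡⟨ cong₂ (λ a b → a - s * b + (s * s - 1ℚ) * (Y - c)) (x≡y⇒x-y≡0 second) (x≡y⇒x-y≡0 first) ⟩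
  0ℚ - s * 0ℚ + (s * s - 1ℚ) * (Y - c)
    ≡⟨ cong (λ w → 0ℚ - s * 0ℚ + (w - 1ℚ) * (Y - c)) s²≡1 ⟩
  0ℚ - s * 0ℚ + (1ℚ - 1ℚ) * (Y - c)
    ≡⟨ vanish s (Y - c) ⟩
  0ℚ
    ∎)
  where
  combine : ∀ s t X Y E c → X - Y ≡
    (s * (t * s * E) - t * s * X + X - c) - s * (s * Y + t * s * E - t * X - s * c) + (s * s - 1ℚ) * (Y - c)
  combine = solve-∀ ring
  vanish : ∀ s a → 0ℚ - s * 0ℚ + (1ℚ - 1ℚ) * a ≡ 0ℚ
  vanish = solve-∀ ring

module _ (N M : ℕ) where

  d : ℕ
  d = suc (N ℕ.+ M)

  N+M≤d : N ℕ.+ M ≤ d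
  N+M≤d = ℕₚ.n≤1+n (N ℕ.+ M)

  -- For n = N + 1 and m = M + 1: R x = E_{m-1}(-x)/2 and Q x = (B_n(-x) - B_n)/n.
  R Q : ℚ → ℚ
  R x = appell halfEuler M (- x)
  Q x = recip N * (appell bernoulli (suc N) (- x) - bernoulli (suc N))

  X Y E : ℚ
  X = ℰ d (λ x → x ^ N * R x)
  Y = ℰ d (λ x → x ^ M * Q x)
  E = halfEuler (N ℕ.+ M)

  R-step : ∀ x → R (x - 1ℚ) + R x ≡ sgn M * x ^ M
  R-step x = begin
    R (x - 1ℚ) + R x                                     ≡⟨ cong (λ y → appell halfEuler M y + R x) (-[x-1]≡-x+1 x) ⟩
    appell halfEuler M (- x + 1ℚ) + R x                  ≡⟨ cong (_+ R x) (appell-appell halfEuler M (- x) 1ℚ) ⟨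
    appell (λ k → appell halfEuler k 1ℚ) M (- x) + R x    ≡⟨ appell-+ (λ k → appell halfEuler k 1ℚ) halfEuler M (- x) ⟨
    appell (λ k → appell halfEuler k 1ℚ + halfEuler k) M (- x)
      ≡⟨ appell-cong M (- x) (λ k _ → halfEuler-recurrence k) ⟩
    appell δ₀ M (- x)                                    ≡⟨ appell-δ₀ M (- x) ⟩
    (- x) ^ M                                            ≡⟨ neg-^ x M ⟩
    sgn M * x ^ M                                        ∎

  R[x+1] : ∀ x → R (x + 1ℚ) ≡ sgn M * (x + 1ℚ) ^ M - R x
  R[x+1] x = x+y≡z⇒y≡z-x (trans (cong (λ y → R y + R (x + 1ℚ)) (cancel x)) (R-step (x + 1ℚ)))
    where
    cancel : ∀ x → x ≡ x + 1ℚ - 1ℚ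
    cancel = solve-∀ ring

  R-reflect : ∀ x → R (- 1ℚ - x) ≡ sgn M * R x
  R-reflect x = begin
    appell halfEuler M (- (- 1ℚ - x))          ≡⟨ cong (appell halfEuler M) (negate x) ⟩
    appell halfEuler M (x + 1ℚ)                ≡⟨ appell-appell halfEuler M x 1ℚ ⟨
    appell (λ k → appell halfEuler k 1ℚ) M x   ≡⟨ appell-cong M x (λ k _ → appell-halfEuler-1 k) ⟩
    appell (λ k → sgn k * halfEuler k) M x     ≡⟨ appell-sgn halfEuler M x ⟩
    sgn M * R x                                ∎
    where
    negate : ∀ x → - (- 1ℚ - x) ≡ x + 1ℚ
    negate = solve-∀ ring

  R-degree : Deg≤ M R
  R-degree = Deg≤-appell-neg halfEuler M

  Q-step : ∀ x → Q (x - 1ℚ) ≡ Q x + sgn N * x ^ N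
  Q-step x = begin
    recip N * (appell bernoulli (suc N) (- (x - 1ℚ)) - b)
      ≡⟨ cong (λ a → recip N * (a - b)) shifted ⟩
    recip N * (appell bernoulli (suc N) (- x) + ℕ→ℚ (suc N) * (sgn N * x ^ N) - b)
      ≡⟨ regroup (recip N) (appell bernoulli (suc N) (- x)) (ℕ→ℚ (suc N)) (sgn N * x ^ N) b ⟩
    Q x + recip N * ℕ→ℚ (suc N) * (sgn N * x ^ N)
      ≡⟨ cong (λ c → Q x + c * (sgn N * x ^ N)) (recip-inverse N) ⟩
    Q x + 1ℚ * (sgn N * x ^ N)
      ≡⟨ cong (Q x +_) (ℚ.*-identityˡ (sgn N * x ^ N)) ⟩
    Q x + sgn N * x ^ N
      ∎
    where
    b : ℚ
    b = bernoulli (suc N)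
    regroup : ∀ r a n t b → r * (a + n * t - b) ≡ r * (a - b) + r * n * t
    regroup = solve-∀ ring
    shifted : appell bernoulli (suc N) (- (x - 1ℚ)) ≡ appell bernoulli (suc N) (- x) + ℕ→ℚ (suc N) * (sgn N * x ^ N)
    shifted = begin
      appell bernoulli (suc N) (- (x - 1ℚ))                      ≡⟨ cong (appell bernoulli (suc N)) (-[x-1]≡-x+1 x) ⟩
      appell bernoulli (suc N) (- x + 1ℚ)                        ≡⟨ appell-appell bernoulli (suc N) (- x) 1ℚ ⟨
      appell (λ k → appell bernoulli k 1ℚ) (suc N) (- x)         ≡⟨ appell-cong (suc N) (- x) (λ k _ → appell-bernoulli-1 k) ⟩
      appell (λ k → bernoulli k + δ₁ k) (suc N) (- x)            ≡⟨ appell-+ bernoulli δ₁ (suc N) (- x) ⟩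
      appell bernoulli (suc N) (- x) + appell δ₁ (suc N) (- x)   ≡⟨ cong (appell bernoulli (suc N) (- x) +_) (appell-δ₁ N (- x)) ⟩
      appell bernoulli (suc N) (- x) + ℕ→ℚ (suc N) * (- x) ^ N
        ≡⟨ cong (λ p → appell bernoulli (suc N) (- x) + ℕ→ℚ (suc N) * p) (neg-^ x N) ⟩
      appell bernoulli (suc N) (- x) + ℕ→ℚ (suc N) * (sgn N * x ^ N)
        ∎

  Q-degree : Deg≤ (suc N) Q
  Q-degree = Deg≤-cong (λ x → as-combination (recip N) (appell bernoulli (suc N) (- x)) (bernoulli (suc N)))
    (Deg≤-linear (recip N) (- (recip N * bernoulli (suc N)))
                 (Deg≤-appell-neg bernoulli (suc N)) (Deg≤-weaken z≤n (Deg≤-const 1ℚ)))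
    where
    as-combination : ∀ r a b → r * a + - (r * b) * 1ℚ ≡ r * (a - b)
    as-combination = solve-∀ ring

  Q[-1] : Q (- 1ℚ) ≡ δ₀ N
  Q[-1] = begin
    recip N * (appell bernoulli (suc N) 1ℚ - bernoulli (suc N))   ≡⟨ cong (λ a → recip N * (a - bernoulli (suc N))) (appell-bernoulli-1 (suc N)) ⟩
    recip N * (bernoulli (suc N) + δ₀ N - bernoulli (suc N))      ≡⟨ cong (recip N *_) (cancel (bernoulli (suc N)) (δ₀ N)) ⟩
    recip N * δ₀ N                                                ≡⟨ recip-*-δ₀ N ⟩
    δ₀ N                                                          ∎
    where
    cancel : ∀ b e → b + e - b ≡ e
    cancel = solve-∀ ring
    recip-*-δ₀ : ∀ n → recip n * δ₀ n ≡ δ₀ n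
    recip-*-δ₀ zero    = refl
    recip-*-δ₀ (suc n) = ℚ.*-zeroʳ (recip (suc n))

  X-reflected : ℰ d (λ x → (x + 1ℚ) ^ N * R x) ≡ sgn N * sgn M * X
  X-reflected = begin
    W                                         ≡⟨ sgn-cancel N W ⟨
    sgn N * (sgn N * W)                       ≡⟨ cong (sgn N *_) (sgn-cancel M (sgn N * W)) ⟨
    sgn N * (sgn M * (sgn M * (sgn N * W)))   ≡⟨ regroup (sgn N) (sgn M) W ⟩
    sgn N * sgn M * (sgn N * sgn M * W)       ≡⟨ cong (sgn N * sgn M *_) X≡σW ⟨
    sgn N * sgn M * X                         ∎
    where
    W : ℚ
    W = ℰ d (λ x → (x + 1ℚ) ^ N * R x)
    regroup : ∀ s t w → s * (t * (t * (s * w))) ≡ s * t * (s * t * w)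
    regroup = solve-∀ ring
    reflected : ∀ x → (- 1ℚ - x) ^ N * R (- 1ℚ - x) ≡ sgn N * sgn M * ((x + 1ℚ) ^ N * R x)
    reflected x = begin
      (- 1ℚ - x) ^ N * R (- 1ℚ - x)          ≡⟨ cong₂ _*_ (trans (cong (_^ N) (negate x)) (neg-^ (x + 1ℚ) N)) (R-reflect x) ⟩
      sgn N * (x + 1ℚ) ^ N * (sgn M * R x)   ≡⟨ interchange (sgn N) (sgn M) ((x + 1ℚ) ^ N) (R x) ⟩
      sgn N * sgn M * ((x + 1ℚ) ^ N * R x)   ∎
      where
      negate : ∀ x → - 1ℚ - x ≡ - (x + 1ℚ)
      negate = solve-∀ ring
      interchange : ∀ s t p r → s * p * (t * r) ≡ s * t * (p * r)
      interchange = solve-∀ ring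
    X≡σW : X ≡ sgn N * sgn M * W
    X≡σW = begin
      X                                                  ≡⟨ ℰ-^-*-appell-neg d (λ x → x) (ℰ-monomial d) halfEuler M N N+M≤d ⟩
      ∑ 0 (suc M) (λ k → coeff halfEuler M k * halfEuler (N ℕ.+ k))
        ≡⟨ ℰ-^-*-appell-neg d (λ x → - 1ℚ - x) (ℰ-reflected-monomial d) halfEuler M N N+M≤d ⟨
      ℰ d (λ x → (- 1ℚ - x) ^ N * R (- 1ℚ - x))          ≡⟨ ℰ-cong d reflected ⟩
      ℰ d (λ x → sgn N * sgn M * ((x + 1ℚ) ^ N * R x))   ≡⟨ ℰ-* d (sgn N * sgn M) (λ x → (x + 1ℚ) ^ N * R x) ⟩
      sgn N * sgn M * W                                  ∎

  u q : ℚ → ℚ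
  u x = x ^ N * R x
  q x = Q (x - 1ℚ) * R (x - 1ℚ)

  u-degree : Deg≤ d u
  u-degree = Deg≤-weaken N+M≤d (Deg≤-* (Deg≤-^ N) R-degree)

  q-degree : Deg≤ d q
  q-degree = Deg≤-* (Deg≤-shift (- 1ℚ) Q-degree) (Deg≤-shift (- 1ℚ) R-degree)

  u[x+1] : ∀ x → u (x + 1ℚ) ≡ sgn M * (x + 1ℚ) ^ (N ℕ.+ M) - (x + 1ℚ) ^ N * R x
  u[x+1] x = begin
    (x + 1ℚ) ^ N * R (x + 1ℚ)                                   ≡⟨ cong ((x + 1ℚ) ^ N *_) (R[x+1] x) ⟩
    (x + 1ℚ) ^ N * (sgn M * (x + 1ℚ) ^ M - R x)                 ≡⟨ distrib (sgn M) ((x + 1ℚ) ^ N) ((x + 1ℚ) ^ M) (R x) ⟩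
    sgn M * ((x + 1ℚ) ^ N * (x + 1ℚ) ^ M) - (x + 1ℚ) ^ N * R x  ≡⟨ cong (λ p → sgn M * p - (x + 1ℚ) ^ N * R x) (^-distribˡ-+-* (x + 1ℚ) N M) ⟨
    sgn M * (x + 1ℚ) ^ (N ℕ.+ M) - (x + 1ℚ) ^ N * R x           ∎
    where
    distrib : ∀ s p q r → p * (s * q - r) ≡ s * (p * q) - p * r
    distrib = solve-∀ ring

  q-expand : ∀ x → q x ≡ sgn M * (x ^ M * Q x) + sgn N * sgn M * x ^ (N ℕ.+ M) - (sgn N * (x ^ N * R x) + Q x * R x)
  q-expand x = begin
    Q (x - 1ℚ) * R (x - 1ℚ)
      ≡⟨ cong₂ _*_ (Q-step x) (x+y≡z⇒x≡z-y (R-step x)) ⟩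
    (Q x + sgn N * x ^ N) * (sgn M * x ^ M - R x)
      ≡⟨ expand (Q x) (R x) (sgn N) (sgn M) (x ^ N) (x ^ M) ⟩
    sgn M * (x ^ M * Q x) + sgn N * sgn M * (x ^ N * x ^ M) - (sgn N * (x ^ N * R x) + Q x * R x)
      ≡⟨ cong (λ p → sgn M * (x ^ M * Q x) + sgn N * sgn M * p - (sgn N * (x ^ N * R x) + Q x * R x)) (^-distribˡ-+-* x N M) ⟨
    sgn M * (x ^ M * Q x) + sgn N * sgn M * x ^ (N ℕ.+ M) - (sgn N * (x ^ N * R x) + Q x * R x)
      ∎
    where
    expand : ∀ q r s t a b → (q + s * a) * (t * b - r) ≡ t * (b * q) + s * t * (a * b) - (s * (a * r) + q * r)
    expand = solve-∀ ring

  ℰ-u[x+1] : ℰ d (λ x → u (x + 1ℚ)) ≡ sgn M * (sgn N * sgn M * E) - sgn N * sgn M * X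
  ℰ-u[x+1] = begin
    ℰ d (λ x → u (x + 1ℚ))
      ≡⟨ ℰ-cong d u[x+1] ⟩
    ℰ d (λ x → sgn M * (x + 1ℚ) ^ (N ℕ.+ M) - (x + 1ℚ) ^ N * R x)
      ≡⟨ ℰ-- d (λ x → sgn M * (x + 1ℚ) ^ (N ℕ.+ M)) (λ x → (x + 1ℚ) ^ N * R x) ⟩
    ℰ d (λ x → sgn M * (x + 1ℚ) ^ (N ℕ.+ M)) - ℰ d (λ x → (x + 1ℚ) ^ N * R x)
      ≡⟨ cong₂ _-_ (ℰ-* d (sgn M) (λ x → (x + 1ℚ) ^ (N ℕ.+ M))) X-reflected ⟩
    sgn M * ℰ d (λ x → (x + 1ℚ) ^ (N ℕ.+ M)) - sgn N * sgn M * X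
      ≡⟨ cong (λ e → sgn M * e - sgn N * sgn M * X)
              (trans (ℰ-shifted-monomial d (N ℕ.+ M) N+M≤d) (cong (_* E) (sgn-+ N M))) ⟩
    sgn M * (sgn N * sgn M * E) - sgn N * sgn M * X
      ∎

  ℰ-q : ℰ d q ≡ sgn M * Y + sgn N * sgn M * E - (sgn N * X + ℰ d (λ x → Q x * R x))
  ℰ-q = begin
    ℰ d q
      ≡⟨ ℰ-cong d q-expand ⟩
    ℰ d (λ x → sgn M * (x ^ M * Q x) + sgn N * sgn M * x ^ (N ℕ.+ M) - (sgn N * (x ^ N * R x) + Q x * R x))
      ≡⟨ ℰ-- d (λ x → sgn M * (x ^ M * Q x) + sgn N * sgn M * x ^ (N ℕ.+ M)) (λ x → sgn N * (x ^ N * R x) + Q x * R x) ⟩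
    ℰ d (λ x → sgn M * (x ^ M * Q x) + sgn N * sgn M * x ^ (N ℕ.+ M)) - ℰ d (λ x → sgn N * (x ^ N * R x) + Q x * R x)
      ≡⟨ cong₂ _-_ (ℰ-+ d (λ x → sgn M * (x ^ M * Q x)) (λ x → sgn N * sgn M * x ^ (N ℕ.+ M)))
                   (ℰ-+ d (λ x → sgn N * (x ^ N * R x)) (λ x → Q x * R x)) ⟩
    ℰ d (λ x → sgn M * (x ^ M * Q x)) + ℰ d (λ x → sgn N * sgn M * x ^ (N ℕ.+ M))
      - (ℰ d (λ x → sgn N * (x ^ N * R x)) + ℰ d (λ x → Q x * R x))
      ≡⟨ cong₂ (λ a b → a + b - (ℰ d (λ x → sgn N * (x ^ N * R x)) + ℰ d (λ x → Q x * R x)))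
               (ℰ-* d (sgn M) (λ x → x ^ M * Q x))
               (trans (ℰ-* d (sgn N * sgn M) (λ x → x ^ (N ℕ.+ M))) (cong (sgn N * sgn M *_) (ℰ-monomial d (N ℕ.+ M) N+M≤d))) ⟩
    sgn M * Y + sgn N * sgn M * E - (ℰ d (λ x → sgn N * (x ^ N * R x)) + ℰ d (λ x → Q x * R x))
      ≡⟨ cong (λ c → sgn M * Y + sgn N * sgn M * E - (c + ℰ d (λ x → Q x * R x))) (ℰ-* d (sgn N) (λ x → x ^ N * R x)) ⟩
    sgn M * Y + sgn N * sgn M * E - (sgn N * X + ℰ d (λ x → Q x * R x))
      ∎

  u-relation : sgn M * (sgn N * sgn M * E) - sgn N * sgn M * X + X ≡ δ₀ N * halfEuler M
  u-relation = begin
    sgn M * (sgn N * sgn M * E) - sgn N * sgn M * X + X   ≡⟨ cong (_+ X) ℰ-u[x+1] ⟨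
    ℰ d (λ x → u (x + 1ℚ)) + X                            ≡⟨ ℰ[p+1]+ℰ[p]≡p[0] u-degree ⟩
    0ℚ ^ N * R 0ℚ                                         ≡⟨ cong₂ _*_ (0^k≡δ₀ N) (appell-0 halfEuler M) ⟩
    δ₀ N * halfEuler M                                    ∎

  q-relation : sgn M * Y + sgn N * sgn M * E - sgn N * X ≡ sgn M * (δ₀ N * halfEuler M)
  q-relation = begin
    sgn M * Y + sgn N * sgn M * E - sgn N * X
      ≡⟨ regroup (sgn M * Y + sgn N * sgn M * E) (sgn N * X) (ℰ d (λ x → Q x * R x)) ⟩
    ℰ d (λ x → Q x * R x) + (sgn M * Y + sgn N * sgn M * E - (sgn N * X + ℰ d (λ x → Q x * R x)))
      ≡⟨ cong₂ _+_ (ℰ-cong d (λ x → cong₂ (λ a b → Q a * R b) (cancel x) (cancel x))) ℰ-q ⟨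
    ℰ d (λ x → q (x + 1ℚ)) + ℰ d q
      ≡⟨ ℰ[p+1]+ℰ[p]≡p[0] q-degree ⟩
    Q (- 1ℚ) * R (- 1ℚ)
      ≡⟨ cong₂ _*_ Q[-1] (appell-halfEuler-1 M) ⟩
    δ₀ N * (sgn M * halfEuler M)
      ≡⟨ swap (δ₀ N) (sgn M) (halfEuler M) ⟩
    sgn M * (δ₀ N * halfEuler M)
      ∎
    where
    regroup : ∀ a b c → a - b ≡ c + (a - (b + c))
    regroup = solve-∀ ring
    cancel : ∀ x → x + 1ℚ - 1ℚ ≡ x
    cancel = solve-∀ ring
    swap : ∀ a s e → a * (s * e) ≡ s * (a * e)
    swap = solve-∀ ring

  X≡Y : X ≡ Y
  X≡Y = cancel-signs {sgn M} {sgn N} {E = E} {δ₀ N * halfEuler M}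
    (trans (cong (sgn M *_) (sym (ℚ.*-identityʳ (sgn M)))) (sgn-cancel M 1ℚ)) q-relation u-relation

  X-expansion : X ≡ recip M * ∑ 0 (suc (suc M)) (λ k → coeff halfGenocchi (suc M) k * halfEuler (N ℕ.+ k))
  X-expansion = begin
    X                                                                   ≡⟨ ℰ-cong d undo-zMul ⟨
    ℰ d (λ x → recip M * (x ^ N * appell halfGenocchi (suc M) (- x)))    ≡⟨ ℰ-* d (recip M) (λ x → x ^ N * appell halfGenocchi (suc M) (- x)) ⟩
    recip M * ℰ d (λ x → x ^ N * appell halfGenocchi (suc M) (- x))
      ≡⟨ cong (recip M *_) (ℰ-^-*-appell-neg d (λ x → x) (ℰ-monomial d) halfGenocchi (suc M) N (ℕₚ.≤-reflexive (ℕₚ.+-suc N M))) ⟩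
    recip M * ∑ 0 (suc (suc M)) (λ k → coeff halfGenocchi (suc M) k * halfEuler (N ℕ.+ k))
      ∎
    where
    undo-zMul : ∀ x → recip M * (x ^ N * appell halfGenocchi (suc M) (- x)) ≡ x ^ N * R x
    undo-zMul x = begin
      recip M * (x ^ N * appell halfGenocchi (suc M) (- x))
        ≡⟨ cong (λ a → recip M * (x ^ N * a)) (appell-cong (suc M) (- x) (λ k _ → halfGenocchi≡zMul-halfEuler k)) ⟩
      recip M * (x ^ N * appell (zMul halfEuler) (suc M) (- x))
        ≡⟨ cong (λ a → recip M * (x ^ N * a)) (appell-zMul halfEuler M (- x)) ⟩
      recip M * (x ^ N * (ℕ→ℚ (suc M) * R x))
        ≡⟨ shuffle (recip M) (x ^ N) (ℕ→ℚ (suc M)) (R x) ⟩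
      recip M * ℕ→ℚ (suc M) * (x ^ N * R x)
        ≡⟨ cong (_* (x ^ N * R x)) (recip-inverse M) ⟩
      1ℚ * (x ^ N * R x)
        ≡⟨ ℚ.*-identityˡ (x ^ N * R x) ⟩
      x ^ N * R x
        ∎
      where
      shuffle : ∀ r p n a → r * (p * (n * a)) ≡ r * n * (p * a)
      shuffle = solve-∀ ring

  Y-expansion : Y ≡ recip N * (∑ 0 (suc (suc N)) (λ k → coeff bernoulli (suc N) k * halfEuler (M ℕ.+ k)) - bernoulli (suc N) * halfEuler M)
  Y-expansion = begin
    Y                                                           ≡⟨ ℰ-cong d (λ x → factor (recip N) (x ^ M) (appell bernoulli (suc N) (- x)) b) ⟨
    ℰ d (λ x → recip N * (x ^ M * A x - b * x ^ M))             ≡⟨ ℰ-* d (recip N) (λ x → x ^ M * A x - b * x ^ M) ⟩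
    recip N * ℰ d (λ x → x ^ M * A x - b * x ^ M)               ≡⟨ cong (recip N *_) (ℰ-- d (λ x → x ^ M * A x) (λ x → b * x ^ M)) ⟩
    recip N * (ℰ d (λ x → x ^ M * A x) - ℰ d (λ x → b * x ^ M))  ≡⟨ cong (λ a → recip N * (ℰ d (λ x → x ^ M * A x) - a)) (ℰ-* d b (λ x → x ^ M)) ⟩
    recip N * (ℰ d (λ x → x ^ M * A x) - b * ℰ d (λ x → x ^ M))
      ≡⟨ cong₂ (λ a e → recip N * (a - b * e))
               (ℰ-^-*-appell-neg d (λ x → x) (ℰ-monomial d) bernoulli (suc N) M M+1+N≤d)
               (ℰ-monomial d M (ℕₚ.≤-trans (ℕₚ.m≤n+m M N) N+M≤d)) ⟩
    recip N * (∑ 0 (suc (suc N)) (λ k → coeff bernoulli (suc N) k * halfEuler (M ℕ.+ k)) - b * halfEuler M)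
      ∎
    where
    b : ℚ
    b = bernoulli (suc N)
    A : ℚ → ℚ
    A x = appell bernoulli (suc N) (- x)
    factor : ∀ r p a b → r * (p * a - b * p) ≡ p * (r * (a - b))
    factor = solve-∀ ring
    M+1+N≤d : M ℕ.+ suc N ≤ d
    M+1+N≤d = ℕₚ.≤-reflexive (trans (ℕₚ.+-suc M N) (cong suc (ℕₚ.+-comm M N)))

  left-side : recip M * sumFromTo 0 (suc M) (λ k → ℕ→ℚ (suc M C k) * sgn k * halfEuler (N ℕ.+ k) * halfGenocchi (suc M ∸ k)) ≡ X
  left-side = begin
    recip M * sumFromTo 0 (suc M) (λ k → ℕ→ℚ (suc M C k) * sgn k * halfEuler (N ℕ.+ k) * halfGenocchi (suc M ∸ k))
      ≡⟨ cong (recip M *_) (sumFromTo≡∑ 0 (suc M) (λ k → ℕ→ℚ (suc M C k) * sgn k * halfEuler (N ℕ.+ k) * halfGenocchi (suc M ∸ k))) ⟩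
    recip M * ∑ 0 (suc (suc M)) (λ k → ℕ→ℚ (suc M C k) * sgn k * halfEuler (N ℕ.+ k) * halfGenocchi (suc M ∸ k))
      ≡⟨ cong (recip M *_) (∑-cong 0 (suc (suc M)) (λ k _ → shuffle (ℕ→ℚ (suc M C k)) (sgn k) (halfEuler (N ℕ.+ k)) (halfGenocchi (suc M ∸ k)))) ⟩
    recip M * ∑ 0 (suc (suc M)) (λ k → coeff halfGenocchi (suc M) k * halfEuler (N ℕ.+ k))
      ≡⟨ X-expansion ⟨
    X ∎
    where
    shuffle : ∀ c s e g → c * s * e * g ≡ c * (s * g) * e
    shuffle = solve-∀ ring

  right-side : recip N * sumFromTo 1 (suc N) (λ k → ℕ→ℚ (suc N C k) * sgn k * halfEuler (M ℕ.+ k) * bernoulli (suc N ∸ k)) ≡ Y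
  right-side = begin
    recip N * sumFromTo 1 (suc N) (λ k → ℕ→ℚ (suc N C k) * sgn k * halfEuler (M ℕ.+ k) * bernoulli (suc N ∸ k))
      ≡⟨ cong (recip N *_) (sumFromTo≡∑ 1 (suc N) (λ k → ℕ→ℚ (suc N C k) * sgn k * halfEuler (M ℕ.+ k) * bernoulli (suc N ∸ k))) ⟩
    recip N * ∑ 1 (suc N) (λ k → ℕ→ℚ (suc N C k) * sgn k * halfEuler (M ℕ.+ k) * bernoulli (suc N ∸ k))
      ≡⟨ cong (recip N *_) (∑-cong 1 (suc N) (λ k _ → shuffle (ℕ→ℚ (suc N C k)) (sgn k) (halfEuler (M ℕ.+ k)) (bernoulli (suc N ∸ k)))) ⟩
    recip N * ∑ 1 (suc N) T
      ≡⟨ cong (recip N *_) drop-first-term ⟩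
    recip N * (∑ 0 (suc (suc N)) T - bernoulli (suc N) * halfEuler M)
      ≡⟨ Y-expansion ⟨
    Y ∎
    where
    T : ℕ → ℚ
    T k = coeff bernoulli (suc N) k * halfEuler (M ℕ.+ k)
    shuffle : ∀ c s e b → c * s * e * b ≡ c * (s * b) * e
    shuffle = solve-∀ ring
    drop-first-term : ∑ 1 (suc N) T ≡ ∑ 0 (suc (suc N)) T - bernoulli (suc N) * halfEuler M
    drop-first-term = trans (add-and-subtract (∑ 1 (suc N) T) (bernoulli (suc N)) (halfEuler M))
      (cong (λ j → 1ℚ * (1ℚ * bernoulli (suc N)) * halfEuler j + ∑ 1 (suc N) T - bernoulli (suc N) * halfEuler M)
            (sym (ℕₚ.+-identityʳ M)))
      where
      add-and-subtract : ∀ t b e → t ≡ 1ℚ * (1ℚ * b) * e + t - b * e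
      add-and-subtract = solve-∀ ring

-- Imported only here: in scope, the prefix +_ makes sections such as (x +_) above ambiguous.
open import Data.Integer using (+_)

corollary3 : (m' n' : ℕ) →
    let m = suc m'
        n = suc n'
    in (+ 1 / m) * sumFromTo 0 m (λ k →
          ℕ→ℚ (m C k) * sgn k
          * (((1ℚ - pow2 (n ℕ.+ k)) * bernoulli (n ℕ.+ k)) * (+ 1 / suc (n' ℕ.+ k)))
          * ((1ℚ - pow2 (m ℕ.∸ k)) * bernoulli (m ℕ.∸ k)))
       ≡
       (+ 1 / n) * sumFromTo 1 n (λ k →
          ℕ→ℚ (n C k) * sgn k
          * (((1ℚ - pow2 (m ℕ.+ k)) * bernoulli (m ℕ.+ k)) * (+ 1 / suc (m' ℕ.+ k)))
          * bernoulli (n ℕ.∸ k))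
corollary3 m' n' = trans (left-side n' m') (trans (X≡Y n' m') (sym (right-side n' m')))
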